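{- Let $1\le k_1<k_2<\cdots<k_s$ and $n$ be positive integers, $p$ a prime and $q=p^r$ for some positive integer $r$, and write $\mathbb{F}_q=\{0,\alpha_1,\dots,\alpha_{q-1}\}$. Let $\beta_1,\dots,\beta_s\in\mathbb{F}_q^{\times}$. Then $$S_{\mathbb{F}_q}\Big(\sum_{j=1}^s \beta_j\boldsymbol{e}_{n,k_j}\Big)=\sum_{\boldsymbol{\lambda}\dashv_q n} \binom{n}{\boldsymbol{\lambda}} \sum_{\boldsymbol{\gamma}\in \mathrm{Sym}(\boldsymbol{\lambda})} \exp\left(\frac{2\pi i}{p} \mathrm{Tr}_{\mathbb{F}_q/\mathbb{F}_p}\Big(\sum_{j=1}^s \beta_j\Lambda_{\alpha_1,\dots, \alpha_{q-1}}(k_j,\boldsymbol{\gamma}^*)\Big)\right).$$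
   Context: $\boldsymbol{e}_{n,k}=\sum_{1\le i_1<\dots<i_k\le n}X_{i_1}\cdots X_{i_k}$. $S_{\mathbb{F}_q}(F)=\sum_{\mathbf{x}\in\mathbb{F}_q^n}\exp\!\big(\tfrac{2\pi i}{p}\mathrm{Tr}_{\mathbb{F}_q/\mathbb{F}_p}(F(\mathbf{x}))\big)$, with $\mathrm{Tr}_{\mathbb{F}_q/\mathbb{F}_p}(\alpha)=\sum_{j=0}^{r-1}\alpha^{p^j}\in\mathbb{F}_p=\{0,\dots,p-1\}$. $\boldsymbol{\lambda}\dashv_q n$ means $\boldsymbol{\lambda}=(\lambda_1,\dots,\lambda_s)$ is an integer partition of $n$ ($\lambda_1\ge\dots\ge\lambda_s\ge1$, $\sum\lambda_i=n$) with $s\le q$ parts, viewed as a list of length $q$ by right-padding with zeros. $\binom{n}{\boldsymbol{\lambda}}$ is the multinomial coefficient $n!/(\lambda_1!\cdots\lambda_q!)$. $\mathrm{Sym}(\boldsymbol{\lambda})$ is the set of all distinct rearrangements of the length-$q$ list $\boldsymbol{\lambda}$. For a list $\boldsymbol{\gamma}$, $\boldsymbol{\gamma}^*$ is the list obtained by removing its first element (so it has $q-1$ entries, used as $m_1,\dots,m_{q-1}$). For $a_1,a_2,\dots\in\mathbb{F}_q$, an integer $k$ and nonnegative integers $m_i$: $\Lambda_{a_1}(k,m)=a_1^k\binom{m}{k}$ (taken to be $0$ if $k<0$ or $k>m$; $a^0=1$), and recursively $\Lambda_{a_1,\dots,a_{l+1}}(k,m_1,\dots,m_{l+1})=\sum_{j=0}^{m_{l+1}}\binom{m_{l+1}}{j}a_{l+1}^j\Lambda_{a_1,\dots,a_l}(k-j,m_1,\dots,m_l)$.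 -}

module Defs where

open import Level using (Level)
open import Algebra.Bundles using (CommutativeRing; Semiring)
import Algebra.Definitions.RawSemiring as RS
open import Data.Bool using (Bool; true; false; if_then_else_)
open import Data.Nat as ℕ using (ℕ; zero; suc; _∸_; _≤_; _≥_; _≤?_; _≥?_; _!; NonZero)
open import Data.Nat.Properties using (_!≢0; m*n≢0)
open import Data.Nat.Combinatorics using (_C_)
open import Data.Nat.DivMod using (_/_)
open import Data.Integer as ℤ using (ℤ; +_; -[1+_])
open import Data.Fin using (Fin; toℕ)
open import Data.List using (List; []; _∷_; _++_; map; concatMap; filter; filterᵇ; foldr;
  length; upTo; allFin; zip; zipWith; reverse; drop; replicate; deduplicate)
open import Data.Nat.ListAction using (sum; product)
import Data.List as L
open import Data.List.Properties using (≡-dec)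
open import Data.List.Relation.Unary.All using (All; all?)
open import Data.List.Relation.Unary.Linked using (Linked; linked?)
open import Data.Product using (Σ; ∃; _×_; _,_)
open import Data.Sum using (_⊎_)
open import Relation.Nullary using (¬_; Dec)
open import Relation.Nullary.Decidable using (_×-dec_; does)
open import Relation.Binary.PropositionalEquality using (_≡_)

lists : ∀ {a} {A : Set a} → ℕ → List A → List (List A)
lists zero    vs = [] ∷ []
lists (suc l) vs = concatMap (λ v → map (v ∷_) (lists l vs)) vs

insertions : ∀ {a} {A : Set a} → A → List A → List (List A)
insertions x []       = (x ∷ []) ∷ []
insertions x (y ∷ ys) = (x ∷ y ∷ ys) ∷ map (y ∷_) (insertions x ys)

perms : ∀ {a} {A : Set a} → List A → List (List A)
perms []       = [] ∷ []
perms (x ∷ xs) = concatMap (insertions x) (perms xs)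

IsPartition : ℕ → List ℕ → Set
IsPartition n l = Linked _≥_ l × All (1 ≤_) l × sum l ≡ n

isPartition? : ∀ n l → Dec (IsPartition n l)
isPartition? n l = linked? _≥?_ l ×-dec (all? (1 ≤?_) l ×-dec (sum l ℕ.≟ n))

-- all integer partitions of n (a partition of n has at most n parts, all ≤ n)
partitions : ℕ → List (List ℕ)
partitions n =
  filter (isPartition? n) (concatMap (λ len → lists len (map suc (upTo n))) (upTo (suc n)))

pad : ℕ → List ℕ → List ℕ
pad q l = l ++ replicate (q ∸ length l) 0

-- partitions λ ⊣_q n (at most q parts), viewed as lists of length q
partitionsQ : ℕ → ℕ → List (List ℕ)
partitionsQ q n = map (pad q) (filter (λ l → length l ≤? q) (partitions n))

Sym : List ℕ → List (List ℕ)
Sym l = deduplicate (≡-dec ℕ._≟_) (perms l)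

prodFact≢0 : ∀ l → NonZero (product (map _! l))
prodFact≢0 []      = _
prodFact≢0 (x ∷ l) = m*n≢0 (x !) (product (map _! l)) {{x !≢0}} {{prodFact≢0 l}}

multinomial : ℕ → List ℕ → ℕ
multinomial n l = (n !) / product (map _! l)
  where instance _ = prodFact≢0 l

module RingDefs {c ℓ : Level} (F : CommutativeRing c ℓ) where
  open CommutativeRing F
  open RS (Semiring.rawSemiring semiring) using (_^_) renaming (_×_ to _·ℕ_) public

  IsField : Set (c Level.⊔ ℓ)
  IsField = (¬ (1# ≈ 0#)) × (∀ x → ¬ (x ≈ 0#) → ∃ λ y → x * y ≈ 1#)

  Σ' : List Carrier → Carrier
  Σ' = foldr _+_ 0#

  Π' : List Carrier → Carrier
  Π' = foldr _*_ 1#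

  select : List Bool → List Carrier → List Carrier
  select (true  ∷ bs) (x ∷ xs) = x ∷ select bs xs
  select (false ∷ bs) (x ∷ xs) = select bs xs
  select _            _        = []

  -- e_{n,k}(x) = Σ_{i₁<…<i_k} x_{i₁}⋯x_{i_k}, n = length x;
  -- subsets {i₁<…<i_k} are encoded as Bool-lists of length n with k entries true
  e : ℕ → List Carrier → Carrier
  e k xs = Σ' (map (λ bs → Π' (select bs xs))
    (filter (λ bs → length (filterᵇ (λ b → b) bs) ℕ.≟ k) (lists (length xs) (true ∷ false ∷ []))))

  ΛBase : Carrier → ℤ → ℕ → Carrier
  ΛBase a (+ k)    m = if does (k ≤? m) then (m C k) ·ℕ (a ^ k) else 0#
  ΛBase a -[1+ _ ] m = 0#

  -- Λ on the list [(a_{l},m_{l}), …, (a_1,m_1)] (reversed order, last element first)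
  Λrev : ℤ → List (Carrier × ℕ) → Carrier
  Λrev k []                          = 0#   -- not used (l ≥ 1 in the paper)
  Λrev k ((a , m) ∷ [])              = ΛBase a k m
  Λrev k ((a , m) ∷ rest@(_ ∷ _))    =
    Σ' (map (λ j → (m C j) ·ℕ ((a ^ j) * Λrev (k ℤ.- + j) rest)) (upTo (suc m)))

  Λ : List Carrier → ℤ → List ℕ → Carrier
  Λ as k ms = Λrev k (reverse (zip as ms))

module Sides {c ℓ c' ℓ' : Level} (F : CommutativeRing c ℓ) (R : CommutativeRing c' ℓ')
             (p r : ℕ) (α : Fin (p ℕ.^ r ∸ 1) → CommutativeRing.Carrier F)
             (tr : CommutativeRing.Carrier F → Fin p) (ζ : CommutativeRing.Carrier R) where
  module FF = CommutativeRing F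
  module RR = CommutativeRing R
  open RingDefs F
  module RD = RingDefs R

  q : ℕ
  q = p ℕ.^ r

  αs : List FF.Carrier
  αs = map α (allFin (q ∸ 1))

  elems : List FF.Carrier
  elems = FF.0# ∷ αs

  -- exp(2πi/p · Tr(a)) rendered as ζ^{Tr(a)}
  ψ : FF.Carrier → RR.Carrier
  ψ a = ζ RD.^ toℕ (tr a)

  Fpoly : List FF.Carrier → List ℕ → List FF.Carrier → FF.Carrier
  Fpoly βs ks x = Σ' (zipWith (λ b k → b FF.* e k x) βs ks)

  LHS : ℕ → List FF.Carrier → List ℕ → RR.Carrier
  LHS n βs ks = RD.Σ' (map (λ x → ψ (Fpoly βs ks x)) (lists n elems))

  RHS : ℕ → List FF.Carrier → List ℕ → RR.Carrier
  RHS n βs ks = RD.Σ' (map (λ lam → multinomial n lam RD.·ℕ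
      RD.Σ' (map (λ γ → ψ (Σ' (zipWith (λ b k → b FF.* Λ αs (+ k) (drop 1 γ)) βs ks))) (Sym lam)))
    (partitionsQ q n))

-- A point x ∈ 𝔽_q^n is a word over the alphabet 𝔽_q = {0, α₁, …, α_{q-1}}, and e_{n,k}(x) depends only
-- on the multiplicities (γ₀, γ₁, …, γ_{q-1}) of its letters: it equals Λ_{α₁,…,α_{q-1}}(k, γ₁, …, γ_{q-1}),
-- because appending a letter a turns e_k into e_k + a·e_{k-1}, and Pascal's rule gives Λ the same
-- recursion in each of its arguments. Grouping the q^n words by multiplicity vector, each γ with |γ| = n
-- comes from n!/γ! words, and these vectors are exactly the rearrangements of the partitions of n into
-- at most q parts. Finally, Tr respects the equality of 𝔽_q: translation by 1 permutes 𝔽_q, so q·1 = 0,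
-- hence d·1 ≠ 0 for 0 < d < p by Bézout, and Tr(a) ∈ {0, …, p-1} is determined by Tr(a)·1.

module Submission where

open import Defs
open import Level using (Level)
open import Algebra.Bundles using (CommutativeRing)
open import Data.Bool using (Bool; true; false; if_then_else_)
open import Data.Nat as ℕ using (ℕ; zero; suc; _≤_; _<_; _≥_; _∸_; _!)
import Data.Nat.Properties as ℕP
open import Data.Nat.Combinatorics using (_C_; nCk+nC[k+1]≡[n+1]C[k+1]; k>n⇒nCk≡0)
open import Data.Nat.ListAction using (sum; product)
open import Data.Nat.DivMod using (_/_; m*n/n≡m; /-congʳ)
open import Data.Nat.ListAction.Properties using (sum-++; sum-↭; product-↭)
open import Data.Integer as ℤ using (ℤ; +_; -[1+_])
import Data.Integer.Properties as ℤP
open import Data.Fin using (Fin; zero; suc; toℕ)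
import Data.Fin.Properties as FinP
open import Data.Fin.Permutation using (permutation)
open import Data.Nat.Divisibility using (∣1⇒≡1; ∣-trans)
open import Data.Nat.Coprimality using (Coprime; coprime-divisor; prime⇒coprime; coprime-Bézout)
open import Data.Nat.GCD using (module Bézout)
open import Data.Nat.Primality using (Prime; prime⇒nonZero; prime⇒nonTrivial)
open import Data.List using (List; []; _∷_; _++_; [_]; map; concatMap; filter; filterᵇ; length;
  upTo; applyUpTo; allFin; tabulate; replicate; drop; zip; zipWith; reverse)
import Data.List.Properties as LP
open import Data.List.Relation.Unary.All as All using (All; []; _∷_)
open import Data.List.Relation.Unary.Any using (here; there)
open import Data.List.Relation.Unary.Unique.Propositional using (Unique)
open import Data.List.Relation.Unary.AllPairs using ([]; _∷_)
open import Data.List.Membership.Propositional using (_∈_)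
import Data.List.Membership.Propositional.Properties as MemP
import Data.List.Relation.Unary.All.Properties as AllP
import Data.List.Relation.Unary.Unique.Propositional.Properties as UniqueP
import Data.List.Relation.Unary.Unique.DecPropositional.Properties as UniqueDecP
open import Data.List.Relation.Unary.Linked as Linked using (Linked; []; [-]; _∷_)
import Data.List.Relation.Unary.Linked.Properties as LinkedP
open import Data.List.Relation.Binary.Permutation.Propositional using (_↭_; ↭-sym; ↭-trans; ↭-refl; ↭-prep; ↭-swap; ↭⇒↭ₛ)
import Data.List.Relation.Binary.Permutation.Propositional.Properties as PermP
open import Data.List.Relation.Binary.Pointwise using (Pointwise-≡⇒≡)
import Data.List.Relation.Unary.Sorted.TotalOrder.Properties as SortedP
open import Relation.Binary.Bundles using (DecTotalOrder)
open import Relation.Binary.Properties.DecTotalOrder ℕP.≤-decTotalOrder using (≥-decTotalOrder)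
open import Data.List.Sort ≥-decTotalOrder using (sort; sort-↭; sort-↗)
open import Data.Product using (∃; _×_; _,_; proj₁; proj₂)
open import Data.Sum using (_⊎_; inj₁; inj₂)
open import Relation.Nullary using (¬_; yes; no; Dec; does; contradiction)
open import Relation.Binary.PropositionalEquality as P using (_≡_; _≢_)
open import Relation.Binary.Definitions using (DecidableEquality)
open import Relation.Unary using (Pred; Decidable)
open import Function using (_∘_)

private variable
  a : Level
  A B : Set a

module RingSums {c ℓ} (R : CommutativeRing c ℓ) where
  open CommutativeRing R
  open RingDefs R
  open import Algebra.Properties.CommutativeMonoid.Mult +-commutativeMonoid using (×-distrib-+)
  open import Algebra.Properties.CommutativeSemigroup +-commutativeSemigroup using (interchange)

  ×-zeroʳ : ∀ n → n ·ℕ 0# ≈ 0#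
  ×-zeroʳ zero    = refl
  ×-zeroʳ (suc n) = trans (+-identityˡ _) (×-zeroʳ n)

  Σ'-cong-All : ∀ {f g : A → Carrier} {xs} → All (λ x → f x ≈ g x) xs → Σ' (map f xs) ≈ Σ' (map g xs)
  Σ'-cong-All []       = refl
  Σ'-cong-All (e ∷ es) = +-cong e (Σ'-cong-All es)

  Σ'-cong : ∀ {f g : A → Carrier} xs → (∀ x → f x ≈ g x) → Σ' (map f xs) ≈ Σ' (map g xs)
  Σ'-cong xs f≈g = Σ'-cong-All (All.tabulate {xs = xs} (λ {x} _ → f≈g x))

  Σ'-zero : ∀ (xs : List A) → Σ' (map (λ _ → 0#) xs) ≈ 0#
  Σ'-zero []       = refl
  Σ'-zero (x ∷ xs) = trans (+-identityˡ _) (Σ'-zero xs)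

  Σ'-distrib-+ : ∀ (f g : A → Carrier) xs → Σ' (map (λ x → f x + g x) xs) ≈ Σ' (map f xs) + Σ' (map g xs)
  Σ'-distrib-+ f g []       = sym (+-identityˡ _)
  Σ'-distrib-+ f g (x ∷ xs) = trans (+-congˡ (Σ'-distrib-+ f g xs)) (interchange _ _ _ _)

  Σ'-++ : ∀ (f : A → Carrier) xs ys → Σ' (map f (xs ++ ys)) ≈ Σ' (map f xs) + Σ' (map f ys)
  Σ'-++ f []       ys = sym (+-identityˡ _)
  Σ'-++ f (x ∷ xs) ys = trans (+-congˡ (Σ'-++ f xs ys)) (sym (+-assoc _ _ _))

  Σ'-concatMap : ∀ (f : B → Carrier) (g : A → List B) xs →
    Σ' (map f (concatMap g xs)) ≈ Σ' (map (λ x → Σ' (map f (g x))) xs)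
  Σ'-concatMap f g []       = refl
  Σ'-concatMap f g (x ∷ xs) = trans (Σ'-++ f (g x) (concatMap g xs)) (+-congˡ (Σ'-concatMap f g xs))

  ×-distrib-Σ' : ∀ n (f : A → Carrier) xs → n ·ℕ Σ' (map f xs) ≈ Σ' (map (λ x → n ·ℕ f x) xs)
  ×-distrib-Σ' n f []       = ×-zeroʳ n
  ×-distrib-Σ' n f (x ∷ xs) = trans (×-distrib-+ _ _ n) (+-congˡ (×-distrib-Σ' n f xs))

  Σ'-zipWith-cong : ∀ {f g : A → B → Carrier} xs ys → (∀ x y → f x y ≈ g x y) → Σ' (zipWith f xs ys) ≈ Σ' (zipWith g xs ys)
  Σ'-zipWith-cong []       _        f≈g = refl
  Σ'-zipWith-cong (x ∷ xs) []       f≈g = refl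
  Σ'-zipWith-cong (x ∷ xs) (y ∷ ys) f≈g = +-cong (f≈g x y) (Σ'-zipWith-cong xs ys f≈g)

  sumBelow : ℕ → (ℕ → Carrier) → Carrier
  sumBelow zero    f = 0#
  sumBelow (suc N) f = f 0 + sumBelow N (λ j → f (suc j))

  sumBelow-cong : ∀ N {f g : ℕ → Carrier} → (∀ j → f j ≈ g j) → sumBelow N f ≈ sumBelow N g
  sumBelow-cong zero    f≈g = refl
  sumBelow-cong (suc N) f≈g = +-cong (f≈g 0) (sumBelow-cong N (λ j → f≈g (suc j)))

  sumBelow-zero : ∀ N {f : ℕ → Carrier} → (∀ j → f j ≈ 0#) → sumBelow N f ≈ 0#
  sumBelow-zero zero    f≈0 = refl
  sumBelow-zero (suc N) f≈0 = trans (+-cong (f≈0 0) (sumBelow-zero N (λ j → f≈0 (suc j)))) (+-identityˡ _)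

  sumBelow-distrib-+ : ∀ N (f g : ℕ → Carrier) → sumBelow N (λ j → f j + g j) ≈ sumBelow N f + sumBelow N g
  sumBelow-distrib-+ zero    f g = sym (+-identityˡ _)
  sumBelow-distrib-+ (suc N) f g = trans (+-congˡ (sumBelow-distrib-+ N _ _)) (interchange _ _ _ _)

  *-distribˡ-sumBelow : ∀ N a (f : ℕ → Carrier) → a * sumBelow N f ≈ sumBelow N (λ j → a * f j)
  *-distribˡ-sumBelow zero    a f = zeroʳ a
  *-distribˡ-sumBelow (suc N) a f = trans (distribˡ _ _ _) (+-congˡ (*-distribˡ-sumBelow N a _))

  sumBelow-suc : ∀ N (f : ℕ → Carrier) → sumBelow (suc N) f ≈ sumBelow N f + f N
  sumBelow-suc zero    f = trans (+-identityʳ _) (sym (+-identityˡ _))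
  sumBelow-suc (suc N) f = trans (+-congˡ (sumBelow-suc N _)) (sym (+-assoc _ _ _))

  Σ'-applyUpTo : ∀ (f : ℕ → Carrier) (g : ℕ → ℕ) N → Σ' (map f (applyUpTo g N)) ≈ sumBelow N (λ j → f (g j))
  Σ'-applyUpTo f g zero    = refl
  Σ'-applyUpTo f g (suc N) = +-congˡ (Σ'-applyUpTo f (λ j → g (suc j)) N)

  Σ'-upTo : ∀ (f : ℕ → Carrier) N → Σ' (map f (upTo N)) ≈ sumBelow N f
  Σ'-upTo f = Σ'-applyUpTo f (λ j → j)

+suc-+suc : ∀ t j → + suc t ℤ.- + suc j ≡ + t ℤ.- + j
+suc-+suc t j = P.trans (ℤP.m-n≡m⊖n (suc t) (suc j))
  (P.trans (ℤP.[1+m]⊖[1+n]≡m⊖n t j) (P.sym (ℤP.m-n≡m⊖n t j)))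

-1-+suc : ∀ k j → (k ℤ.- + 1) ℤ.- + j ≡ k ℤ.- + suc j
-1-+suc k j = P.trans (ℤP.+-assoc k _ _) (P.cong (λ z → k ℤ.+ z) (P.sym (ℤP.neg-distrib-+ (+ 1) (+ j))))

-+-comm : ∀ k i j → (k ℤ.- + i) ℤ.- + j ≡ (k ℤ.- + j) ℤ.- + i
-+-comm k i j = xy∙z≈xz∙y k (ℤ.- + i) (ℤ.- + j)
  where open import Algebra.Properties.CommutativeSemigroup ℤP.+-commutativeSemigroup using (xy∙z≈xz∙y)

module LambdaRecursion {c ℓ} (R : CommutativeRing c ℓ) where
  open CommutativeRing R
  open RingDefs R
  open RingSums R
  open import Relation.Binary.Reasoning.Setoid setoid
  open import Algebra.Properties.Semiring.Mult semiring using (×-congʳ; ×-congˡ; ×-homo-+; ×-comm-*; ×-assoc-*)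
  open import Algebra.Properties.CommutativeMonoid.Mult +-commutativeMonoid using (×-distrib-+)
  open import Algebra.Properties.CommutativeSemigroup *-commutativeSemigroup using (x∙yz≈y∙xz)

  δ₀ : ℤ → Carrier
  δ₀ (+ zero)  = 1#
  δ₀ (+ suc _) = 0#
  δ₀ -[1+ _ ]  = 0#

  -- Λrev, except that Λ′ k [] = δ₀ k rather than 0; this makes Pascal's rule below uniform.
  Λ′ : ℤ → List (Carrier × ℕ) → Carrier
  Λ′ k []               = δ₀ k
  Λ′ k ((a , m) ∷ rest) = sumBelow (suc m) (λ j → (m C j) ·ℕ (a ^ j * Λ′ (k ℤ.- + j) rest))

  sumBelow-δ₀-hit : ∀ N (h : ℕ → Carrier) t → t < N → sumBelow N (λ j → h j * δ₀ (+ t ℤ.- + j)) ≈ h t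
  sumBelow-δ₀-hit (suc N) h zero    _ =
    trans (+-cong (*-identityʳ _) (sumBelow-zero N (λ j → zeroʳ _))) (+-identityʳ _)
  sumBelow-δ₀-hit (suc N) h (suc t) (ℕ.s≤s t<N) = trans (+-cong (zeroʳ _)
    (trans (sumBelow-cong N (λ j → *-congˡ (reflexive (P.cong δ₀ (+suc-+suc t j)))))
           (sumBelow-δ₀-hit N (λ j → h (suc j)) t t<N)))
    (+-identityˡ _)

  sumBelow-δ₀-miss : ∀ N (h : ℕ → Carrier) t → N ≤ t → sumBelow N (λ j → h j * δ₀ (+ t ℤ.- + j)) ≈ 0#
  sumBelow-δ₀-miss zero    h t       _ = refl
  sumBelow-δ₀-miss (suc N) h (suc t) (ℕ.s≤s N≤t) = trans (+-cong (zeroʳ _)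
    (trans (sumBelow-cong N (λ j → *-congˡ (reflexive (P.cong δ₀ (+suc-+suc t j)))))
           (sumBelow-δ₀-miss N (λ j → h (suc j)) t N≤t)))
    (+-identityˡ _)

  ΛBase≈Λ′ : ∀ a k m → ΛBase a k m ≈ Λ′ k [ (a , m) ]
  ΛBase≈Λ′ a -[1+ n ] m = sym (sumBelow-zero (suc m) {λ j → (m C j) ·ℕ (a ^ j * δ₀ (-[1+ n ] ℤ.- + j))} λ j →
    trans (×-congʳ (m C j) (trans (*-congˡ (reflexive (δ₀-neg j))) (zeroʳ _))) (×-zeroʳ (m C j)))
    where
    δ₀-neg : ∀ j → δ₀ (-[1+ n ] ℤ.- + j) ≡ 0#
    δ₀-neg zero    = P.refl
    δ₀-neg (suc j) = P.refl
  ΛBase≈Λ′ a (+ t) m = trans (base (t ℕ.≤? m))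
    (sumBelow-cong (suc m) {λ j → coeff j * δ₀ (+ t ℤ.- + j)} (λ j → ×-assoc-* (m C j) (a ^ j) _))
    where
    coeff : ℕ → Carrier
    coeff j = (m C j) ·ℕ (a ^ j)
    base : (t≤?m : Dec (t ≤ m)) →
      (if does t≤?m then coeff t else 0#) ≈ sumBelow (suc m) (λ j → coeff j * δ₀ (+ t ℤ.- + j))
    base (yes t≤m) = sym (sumBelow-δ₀-hit (suc m) coeff t (ℕ.s≤s t≤m))
    base (no  t≰m) = sym (sumBelow-δ₀-miss (suc m) coeff t (ℕP.≰⇒> t≰m))

  Λrev≈Λ′ : ∀ k L → 1 ≤ length L → Λrev k L ≈ Λ′ k L
  Λrev≈Λ′ k ((a , m) ∷ [])             _ = ΛBase≈Λ′ a k m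
  Λrev≈Λ′ k ((a , m) ∷ rest@(_ ∷ _)) _ = trans (Σ'-upTo _ (suc m))
    (sumBelow-cong (suc m) {λ j → (m C j) ·ℕ (a ^ j * Λrev (k ℤ.- + j) rest)}
      (λ j → ×-congʳ (m C j) (*-congˡ (Λrev≈Λ′ (k ℤ.- + j) rest (ℕ.s≤s ℕ.z≤n)))))

  Λ′-pascal-head : ∀ k a c rest →
    Λ′ k ((a , suc c) ∷ rest) ≈ Λ′ k ((a , c) ∷ rest) + a * Λ′ (k ℤ.- + 1) ((a , c) ∷ rest)
  Λ′-pascal-head k a c rest = begin
      1 ·ℕ (1# * Rest 0) + sumBelow (suc c) (λ j → (suc c C suc j) ·ℕ Term (suc j))
    ≈⟨ +-congˡ (sumBelow-cong (suc c) pascal) ⟩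
      1 ·ℕ (1# * Rest 0) + sumBelow (suc c) (λ j → Lower j + Upper j)
    ≈⟨ +-congˡ (trans (sumBelow-distrib-+ (suc c) Lower Upper) (+-comm _ _)) ⟩
      1 ·ℕ (1# * Rest 0) + (sumBelow (suc c) Upper + sumBelow (suc c) Lower)
    ≈⟨ sym (+-assoc _ _ _) ⟩
      (1 ·ℕ (1# * Rest 0) + sumBelow (suc c) Upper) + sumBelow (suc c) Lower
    ≈⟨ +-cong (+-congˡ (trans (sumBelow-suc c Upper) (trans (+-congˡ upper-last) (+-identityʳ _)))) lower ⟩
      Λ′ k ((a , c) ∷ rest) + a * Λ′ (k ℤ.- + 1) ((a , c) ∷ rest)
    ∎
    where
    Rest : ℕ → Carrier
    Rest j = Λ′ (k ℤ.- + j) rest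
    Term Lower Upper : ℕ → Carrier
    Term j  = a ^ j * Rest j
    Lower j = (c C j) ·ℕ Term (suc j)
    Upper j = (c C suc j) ·ℕ Term (suc j)
    pascal : ∀ j → (suc c C suc j) ·ℕ Term (suc j) ≈ Lower j + Upper j
    pascal j = trans (×-congˡ (P.sym (nCk+nC[k+1]≡[n+1]C[k+1] c j))) (×-homo-+ _ (c C j) (c C suc j))
    upper-last : Upper c ≈ 0#
    upper-last = ×-congˡ (k>n⇒nCk≡0 (ℕP.n<1+n c))
    Shifted : ℕ → Carrier
    Shifted j = (c C j) ·ℕ (a ^ j * Λ′ ((k ℤ.- + 1) ℤ.- + j) rest)
    lower : sumBelow (suc c) Lower ≈ a * Λ′ (k ℤ.- + 1) ((a , c) ∷ rest)
    lower = sym (trans (*-distribˡ-sumBelow (suc c) a Shifted) (sumBelow-cong (suc c) {g = Lower} λ j →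
      trans (×-comm-* (c C j) a _) (×-congʳ (c C j)
        (trans (sym (*-assoc _ _ _)) (*-congˡ (reflexive (P.cong (λ z → Λ′ z rest) (-1-+suc k j))))))))

  Λ′-pascal : ∀ (A : List (Carrier × ℕ)) a c B k →
    Λ′ k (A ++ (a , suc c) ∷ B) ≈ Λ′ k (A ++ (a , c) ∷ B) + a * Λ′ (k ℤ.- + 1) (A ++ (a , c) ∷ B)
  Λ′-pascal []            a c B k = Λ′-pascal-head k a c B
  Λ′-pascal ((b , d) ∷ A) a c B k = begin
      sumBelow (suc d) (λ j → (d C j) ·ℕ (b ^ j * Λ′ (k ℤ.- + j) (A ++ (a , suc c) ∷ B)))
    ≈⟨ sumBelow-cong (suc d) split ⟩
      sumBelow (suc d) (λ j → Same j + Shifted j)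
    ≈⟨ sumBelow-distrib-+ (suc d) Same Shifted ⟩
      sumBelow (suc d) Same + sumBelow (suc d) Shifted
    ≈⟨ +-congˡ shifted ⟩
      Λ′ k ((b , d) ∷ A ++ (a , c) ∷ B) + a * Λ′ (k ℤ.- + 1) ((b , d) ∷ A ++ (a , c) ∷ B)
    ∎
    where
    Lower : ℤ → Carrier
    Lower z = Λ′ z (A ++ (a , c) ∷ B)
    Same Shifted : ℕ → Carrier
    Same j    = (d C j) ·ℕ (b ^ j * Lower (k ℤ.- + j))
    Shifted j = (d C j) ·ℕ (b ^ j * (a * Lower ((k ℤ.- + j) ℤ.- + 1)))
    split : ∀ j → (d C j) ·ℕ (b ^ j * Λ′ (k ℤ.- + j) (A ++ (a , suc c) ∷ B)) ≈ Same j + Shifted j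
    split j = trans (×-congʳ (d C j) (trans (*-congˡ (Λ′-pascal A a c B (k ℤ.- + j))) (distribˡ _ _ _)))
                    (×-distrib-+ _ _ (d C j))
    shifted : sumBelow (suc d) Shifted ≈ a * Λ′ (k ℤ.- + 1) ((b , d) ∷ A ++ (a , c) ∷ B)
    shifted = sym (trans (*-distribˡ-sumBelow (suc d) a (λ j → (d C j) ·ℕ (b ^ j * Lower ((k ℤ.- + 1) ℤ.- + j))))
      (sumBelow-cong (suc d) {g = Shifted} λ j → trans (×-comm-* (d C j) a _)
        (×-congʳ (d C j) (trans (x∙yz≈y∙xz a _ _) (*-congˡ (*-congˡ (reflexive (P.cong Lower (-+-comm k 1 j)))))))))

  Λ′-zeros : ∀ (as : List Carrier) k → Λ′ k (map (λ a → (a , 0)) as) ≈ δ₀ k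
  Λ′-zeros []       k = refl
  Λ′-zeros (a ∷ as) k = begin
      1 ·ℕ (a ^ 0 * Λ′ (k ℤ.- + 0) (map (λ a → (a , 0)) as)) + 0#
    ≈⟨ trans (+-identityʳ _) (trans (+-identityʳ _) (*-identityˡ _)) ⟩
      Λ′ (k ℤ.- + 0) (map (λ a → (a , 0)) as)
    ≡⟨ P.cong (λ z → Λ′ z (map (λ a → (a , 0)) as)) (ℤP.+-identityʳ k) ⟩
      Λ′ k (map (λ a → (a , 0)) as)
    ≈⟨ Λ′-zeros as k ⟩
      δ₀ k
    ∎

module ElementarySymmetric {c ℓ} (R : CommutativeRing c ℓ) where
  open CommutativeRing R
  open RingDefs R
  open RingSums R
  open LambdaRecursion R using (δ₀)
  open import Relation.Binary.Reasoning.Setoid setoid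

  esym : ℤ → List Carrier → Carrier
  esym k []       = δ₀ k
  esym k (a ∷ xs) = esym k xs + a * esym (k ℤ.- + 1) xs

  esym-neg : ∀ n xs → esym -[1+ n ] xs ≈ 0#
  esym-neg n []       = refl
  esym-neg n (a ∷ xs) =
    trans (+-cong (esym-neg n xs) (trans (*-congˡ (esym-neg (suc (n ℕ.+ 0)) xs)) (zeroʳ a))) (+-identityˡ _)

  hasWeight? : ∀ k (bs : List Bool) → Dec (length (filterᵇ (λ b → b) bs) ≡ k)
  hasWeight? k bs = length (filterᵇ (λ b → b) bs) ℕ.≟ k

  subsets : ℕ → List (List Bool)
  subsets n = lists n (true ∷ false ∷ [])

  monomial : List Carrier → List Bool → Carrier
  monomial xs bs = Π' (select bs xs)

  filter-hasWeight-false∷ : ∀ k L → filter (hasWeight? k) (map (false ∷_) L) ≡ map (false ∷_) (filter (hasWeight? k) L)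
  filter-hasWeight-false∷ k []       = P.refl
  filter-hasWeight-false∷ k (bs ∷ L) with does (hasWeight? k bs)
  ... | true  = P.cong ((false ∷ bs) ∷_) (filter-hasWeight-false∷ k L)
  ... | false = filter-hasWeight-false∷ k L

  filter-hasWeight-true∷ : ∀ k L →
    filter (hasWeight? (suc k)) (map (true ∷_) L) ≡ map (true ∷_) (filter (hasWeight? k) L)
  filter-hasWeight-true∷ k []       = P.refl
  filter-hasWeight-true∷ k (bs ∷ L) with does (hasWeight? k bs)
  ... | true  = P.cong ((true ∷ bs) ∷_) (filter-hasWeight-true∷ k L)
  ... | false = filter-hasWeight-true∷ k L

  filter-hasWeight₀-true∷ : ∀ L → filter (hasWeight? 0) (map (true ∷_) L) ≡ []
  filter-hasWeight₀-true∷ []       = P.refl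
  filter-hasWeight₀-true∷ (bs ∷ L) = filter-hasWeight₀-true∷ L

  Σ'-monomial-true∷ : ∀ a xs L → Σ' (map (monomial (a ∷ xs)) (map (true ∷_) L)) ≈ a * Σ' (map (monomial xs) L)
  Σ'-monomial-true∷ a xs []       = sym (zeroʳ a)
  Σ'-monomial-true∷ a xs (bs ∷ L) = trans (+-congˡ (Σ'-monomial-true∷ a xs L)) (sym (distribˡ _ _ _))

  Σ'-monomial-false∷ : ∀ a xs L → Σ' (map (monomial (a ∷ xs)) (map (false ∷_) L)) ≡ Σ' (map (monomial xs) L)
  Σ'-monomial-false∷ a xs []       = P.refl
  Σ'-monomial-false∷ a xs (bs ∷ L) = P.cong (λ z → monomial xs bs + z) (Σ'-monomial-false∷ a xs L)

  e-∷ : ∀ k a xs →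
    e k (a ∷ xs) ≈ Σ' (map (monomial (a ∷ xs)) (filter (hasWeight? k) (map (true ∷_) (subsets (length xs))))) + e k xs
  e-∷ k a xs = begin
      Σ' (map (monomial (a ∷ xs)) (filter (hasWeight? k) (map (true ∷_) L ++ map (false ∷_) L ++ [])))
    ≡⟨ P.cong (λ z → Σ' (map (monomial (a ∷ xs)) z)) (LP.filter-++ (hasWeight? k) (map (true ∷_) L) _) ⟩
      Σ' (map (monomial (a ∷ xs)) (withA ++ filter (hasWeight? k) (map (false ∷_) L ++ [])))
    ≈⟨ Σ'-++ (monomial (a ∷ xs)) withA _ ⟩
      Σ' (map (monomial (a ∷ xs)) withA) + Σ' (map (monomial (a ∷ xs)) (filter (hasWeight? k) (map (false ∷_) L ++ [])))
    ≡⟨ P.cong (λ z → Σ' (map (monomial (a ∷ xs)) withA) + Σ' (map (monomial (a ∷ xs)) z))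
         (P.trans (P.cong (filter (hasWeight? k)) (LP.++-identityʳ (map (false ∷_) L))) (filter-hasWeight-false∷ k L)) ⟩
      Σ' (map (monomial (a ∷ xs)) withA) + Σ' (map (monomial (a ∷ xs)) (map (false ∷_) (filter (hasWeight? k) L)))
    ≡⟨ P.cong (λ z → Σ' (map (monomial (a ∷ xs)) withA) + z) (Σ'-monomial-false∷ a xs (filter (hasWeight? k) L)) ⟩
      Σ' (map (monomial (a ∷ xs)) withA) + e k xs
    ∎
    where
    L = subsets (length xs)
    withA = filter (hasWeight? k) (map (true ∷_) L)

  e₀-∷ : ∀ a xs → e 0 (a ∷ xs) ≈ e 0 xs
  e₀-∷ a xs = trans (e-∷ 0 a xs) (trans (+-congʳ (reflexive
    (P.cong (λ z → Σ' (map (monomial (a ∷ xs)) z)) (filter-hasWeight₀-true∷ (subsets (length xs)))))) (+-identityˡ _))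

  e-suc-∷ : ∀ k a xs → e (suc k) (a ∷ xs) ≈ e (suc k) xs + a * e k xs
  e-suc-∷ k a xs = trans (e-∷ (suc k) a xs) (trans (+-comm _ _) (+-congˡ (trans (reflexive
    (P.cong (λ z → Σ' (map (monomial (a ∷ xs)) z)) (filter-hasWeight-true∷ k (subsets (length xs)))))
    (Σ'-monomial-true∷ a xs (filter (hasWeight? k) (subsets (length xs)))))))

  e≈esym : ∀ xs k → e k xs ≈ esym (+ k) xs
  e≈esym []       zero    = +-identityʳ _
  e≈esym []       (suc k) = refl
  e≈esym (a ∷ xs) zero    = trans (e₀-∷ a xs) (trans (e≈esym xs 0)
    (sym (trans (+-congˡ (trans (*-congˡ (esym-neg 0 xs)) (zeroʳ a))) (+-identityʳ _))))
  e≈esym (a ∷ xs) (suc k) = trans (e-suc-∷ k a xs) (+-cong (e≈esym xs (suc k)) (*-congˡ (e≈esym xs k)))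

incAt : ∀ {q} → Fin q → List ℕ → List ℕ
incAt _       []       = []
incAt zero    (x ∷ xs) = suc x ∷ xs
incAt (suc i) (x ∷ xs) = x ∷ incAt i xs

multiplicities : ∀ {q} → List (Fin q) → List ℕ
multiplicities {q} []      = replicate q 0
multiplicities     (i ∷ w) = incAt i (multiplicities w)

length-incAt : ∀ {q} (i : Fin q) u → length (incAt i u) ≡ length u
length-incAt _       []       = P.refl
length-incAt zero    (x ∷ u) = P.refl
length-incAt (suc i) (x ∷ u) = P.cong suc (length-incAt i u)

length-multiplicities : ∀ {q} (w : List (Fin q)) → length (multiplicities {q} w) ≡ q
length-multiplicities {q} []      = LP.length-replicate q
length-multiplicities     (i ∷ w) = P.trans (length-incAt i (multiplicities w)) (length-multiplicities w)

zip-tabulate-incAt : ∀ {m} (f : Fin m → A) (j : Fin m) (v : List ℕ) → length v ≡ m →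
  ∃ λ X → ∃ λ Y → ∃ λ c →
    zip (tabulate f) (incAt j v) ≡ X ++ (f j , suc c) ∷ Y × zip (tabulate f) v ≡ X ++ (f j , c) ∷ Y
zip-tabulate-incAt f zero    (x ∷ v) _   = [] , zip (tabulate (λ i → f (suc i))) v , x , P.refl , P.refl
zip-tabulate-incAt f (suc j) (x ∷ v) len with zip-tabulate-incAt (λ i → f (suc i)) j v (ℕP.suc-injective len)
... | X , Y , c , inc≡ , ≡ = (f zero , x) ∷ X , Y , c , P.cong ((f zero , x) ∷_) inc≡ , P.cong ((f zero , x) ∷_) ≡

zip-tabulate-replicate : ∀ {m} (f : Fin m → A) → zip (tabulate f) (replicate m 0) ≡ map (λ a → (a , 0)) (tabulate f)
zip-tabulate-replicate {m = zero}  f = P.refl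
zip-tabulate-replicate {m = suc m} f = P.cong ((f zero , 0) ∷_) (zip-tabulate-replicate (λ i → f (suc i)))

length-zip-tabulate : ∀ {m} (f : Fin m → A) (v : List ℕ) → length v ≡ m → length (zip (tabulate f) v) ≡ m
length-zip-tabulate {m = zero}  f []      _   = P.refl
length-zip-tabulate {m = suc m} f (x ∷ v) len = P.cong suc (length-zip-tabulate (λ i → f (suc i)) v (ℕP.suc-injective len))

reverse-++-∷ : ∀ (X : List A) z Y → reverse (X ++ z ∷ Y) ≡ reverse Y ++ z ∷ reverse X
reverse-++-∷ X z Y = P.trans (LP.reverse-++ X (z ∷ Y))
  (P.trans (P.cong (_++ reverse X) (LP.unfold-reverse z Y)) (LP.++-assoc (reverse Y) [ z ] (reverse X)))

withZero : ∀ {c ℓ} (R : CommutativeRing c ℓ) {m} → (Fin m → CommutativeRing.Carrier R) → Fin (suc m) → CommutativeRing.Carrier R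
withZero R α zero    = CommutativeRing.0# R
withZero R α (suc i) = α i

module ElementarySymmetricOfWords {c ℓ} (R : CommutativeRing c ℓ) {m} (α : Fin m → CommutativeRing.Carrier R) where
  open CommutativeRing R
  open RingDefs R
  open LambdaRecursion R
  open ElementarySymmetric R using (esym; e≈esym)

  letter : Fin (suc m) → Carrier
  letter = withZero R α

  -- the multiplicity vector (γ₀, γ₁, …, γₘ) of a word becomes the argument [(αₘ, γₘ), …, (α₁, γ₁)] of Λ′
  pairs : List ℕ → List (Carrier × ℕ)
  pairs u = reverse (zip (tabulate α) (drop 1 u))

  Λ′-pairs-incAt : ∀ u → length u ≡ suc m → ∀ i k →
    Λ′ k (pairs (incAt i u)) ≈ Λ′ k (pairs u) + letter i * Λ′ (k ℤ.- + 1) (pairs u)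
  Λ′-pairs-incAt (x ∷ v) len zero    k = sym (trans (+-congˡ (zeroˡ _)) (+-identityʳ _))
  Λ′-pairs-incAt (x ∷ v) len (suc j) k with zip-tabulate-incAt α j v (ℕP.suc-injective len)
  ... | X , Y , c , inc≡ , ≡
    rewrite inc≡ | ≡ | reverse-++-∷ X (α j , suc c) Y | reverse-++-∷ X (α j , c) Y =
      Λ′-pascal (reverse Y) (α j) c (reverse X) k

  Λ′-pairs-zeros : ∀ k → Λ′ k (pairs (replicate (suc m) 0)) ≈ δ₀ k
  Λ′-pairs-zeros k rewrite zip-tabulate-replicate α | P.sym (LP.reverse-map (λ a → (a , 0)) (tabulate α)) =
    Λ′-zeros (reverse (tabulate α)) k

  esym≈Λ′-multiplicities : ∀ (w : List (Fin (suc m))) k → esym k (map letter w) ≈ Λ′ k (pairs (multiplicities w))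
  esym≈Λ′-multiplicities []      k = sym (Λ′-pairs-zeros k)
  esym≈Λ′-multiplicities (i ∷ w) k =
    trans (+-cong (esym≈Λ′-multiplicities w k) (*-congˡ (esym≈Λ′-multiplicities w (k ℤ.- + 1))))
          (sym (Λ′-pairs-incAt (multiplicities w) (length-multiplicities w) i k))

  length-pairs : ∀ u → length u ≡ suc m → length (pairs u) ≡ m
  length-pairs (x ∷ v) len =
    P.trans (LP.length-reverse (zip (tabulate α) v)) (length-zip-tabulate α v (ℕP.suc-injective len))

  Λ≈Λ′-pairs : 1 ≤ m → ∀ k u → length u ≡ suc m → Λ (map α (allFin m)) k (drop 1 u) ≈ Λ′ k (pairs u)
  Λ≈Λ′-pairs 1≤m k u len rewrite LP.map-tabulate (λ i → i) α =
    Λrev≈Λ′ k (pairs u) (ℕP.≤-trans 1≤m (ℕP.≤-reflexive (P.sym (length-pairs u len))))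

  e≈Λ-multiplicities : 1 ≤ m → ∀ (w : List (Fin (suc m))) k →
    e k (map letter w) ≈ Λ (map α (allFin m)) (+ k) (drop 1 (multiplicities w))
  e≈Λ-multiplicities 1≤m w k = trans (e≈esym (map letter w) k) (trans (esym≈Λ′-multiplicities w (+ k))
    (sym (Λ≈Λ′-pairs 1≤m (+ k) (multiplicities w) (length-multiplicities w))))

sum-map-cong : ∀ {f g : A → ℕ} {xs} → All (λ x → f x ≡ g x) xs → sum (map f xs) ≡ sum (map g xs)
sum-map-cong []       = P.refl
sum-map-cong (e ∷ es) = P.cong₂ ℕ._+_ e (sum-map-cong es)

sum-map-zero : ∀ {f : A → ℕ} {xs} → All (λ x → f x ≡ 0) xs → sum (map f xs) ≡ 0
sum-map-zero []       = P.refl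
sum-map-zero (e ∷ es) = P.cong₂ ℕ._+_ e (sum-map-zero es)

sum-map-*ʳ : ∀ (f : A → ℕ) xs c → sum (map f xs) ℕ.* c ≡ sum (map (λ x → f x ℕ.* c) xs)
sum-map-*ʳ f []       c = P.refl
sum-map-*ʳ f (x ∷ xs) c = P.trans (ℕP.*-distribʳ-+ c (f x) _) (P.cong (λ z → f x ℕ.* c ℕ.+ z) (sum-map-*ʳ f xs c))

module Occurrences {a} {A : Set a} (_≟_ : DecidableEquality A) where

  indicator : A → A → ℕ
  indicator x y = if does (x ≟ y) then 1 else 0

  occurrences : A → List A → ℕ
  occurrences x xs = sum (map (indicator x) xs)

  indicator-refl : ∀ x → indicator x x ≡ 1
  indicator-refl x with x ≟ x
  ... | yes _  = P.refl
  ... | no x≢x = contradiction P.refl x≢x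

  indicator-≢ : ∀ {x y} → x ≢ y → indicator x y ≡ 0
  indicator-≢ {x} {y} x≢y with x ≟ y
  ... | yes x≡y = contradiction x≡y x≢y
  ... | no  _   = P.refl

  occurrences-++ : ∀ x xs ys → occurrences x (xs ++ ys) ≡ occurrences x xs ℕ.+ occurrences x ys
  occurrences-++ x xs ys = P.trans (P.cong sum (LP.map-++ (indicator x) xs ys)) (sum-++ (map (indicator x) xs) _)

  occurrences-concatMap : ∀ x (g : B → List A) ys → occurrences x (concatMap g ys) ≡ sum (map (λ y → occurrences x (g y)) ys)
  occurrences-concatMap x g []       = P.refl
  occurrences-concatMap x g (y ∷ ys) =
    P.trans (occurrences-++ x (g y) (concatMap g ys)) (P.cong (λ z → occurrences x (g y) ℕ.+ z) (occurrences-concatMap x g ys))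

  occurrences-none : ∀ x {xs} → All (_≢ x) xs → occurrences x xs ≡ 0
  occurrences-none x = sum-map-zero ∘ All.map (λ y≢x → indicator-≢ (y≢x ∘ P.sym))

  occurrences-unique : ∀ {x xs} → Unique xs → x ∈ xs → occurrences x xs ≡ 1
  occurrences-unique {x} (x∉ ∷ _) (here P.refl) = P.cong₂ ℕ._+_ (indicator-refl x) (occurrences-none x (All.map (_∘ P.sym) x∉))
  occurrences-unique (y∉ ∷ u) (there x∈) =
    P.cong₂ ℕ._+_ (indicator-≢ (λ { P.refl → All.lookup y∉ x∈ P.refl })) (occurrences-unique u x∈)

  occurrences-filter : ∀ {p} {Pr : Pred A p} (Pr? : Decidable Pr) {x} → Pr x → ∀ xs → occurrences x (filter Pr? xs) ≡ occurrences x xs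
  occurrences-filter Pr? px [] = P.refl
  occurrences-filter Pr? {x} px (y ∷ xs) with Pr? y
  ... | yes _ = P.cong (λ z → indicator x y ℕ.+ z) (occurrences-filter Pr? px xs)
  ... | no ¬py = P.trans (occurrences-filter Pr? px xs) (P.sym (P.cong (ℕ._+ occurrences x xs) (indicator-≢ λ { P.refl → ¬py px })))

  occurrences-map-injective : ∀ (f : A → A) x xs → All (λ y → f y ≡ f x → y ≡ x) xs → occurrences (f x) (map f xs) ≡ occurrences x xs
  occurrences-map-injective f x xs inj = P.trans (P.cong sum (P.sym (LP.map-∘ xs))) (sum-map-cong (All.map same inj))
    where
    same : ∀ {y} → (f y ≡ f x → y ≡ x) → indicator (f x) (f y) ≡ indicator x y
    same {y} fy≡fx→y≡x with x ≟ y
    ... | yes P.refl = indicator-refl (f x)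
    ... | no  x≢y    = indicator-≢ (λ fx≡fy → x≢y (P.sym (fy≡fx→y≡x (P.sym fx≡fy))))

module OccNat = Occurrences ℕ._≟_
module OccList = Occurrences (LP.≡-dec ℕ._≟_)

length-lists : ∀ l (V : List A) → All (λ x → length x ≡ l) (lists l V)
length-lists zero    V = P.refl ∷ []
length-lists (suc l) V =
  AllP.concat⁺ (AllP.map⁺ (All.tabulate {xs = V} λ _ → AllP.map⁺ (All.map (P.cong suc) (length-lists l V))))

module _ (_≟_ : DecidableEquality A) where
  open Occurrences _≟_
  private module Occ* = Occurrences (LP.≡-dec _≟_)

  occurrences-lists : ∀ V l x → All (λ y → occurrences y V ≡ 1) x → Occ*.occurrences x (lists l V) ≡ OccNat.indicator (length x) l
  occurrences-lists V zero    []      _ = P.refl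
  occurrences-lists V zero    (y ∷ x) _ = P.refl
  occurrences-lists V (suc l) []      _ = P.trans (Occ*.occurrences-concatMap [] (λ v → map (v ∷_) (lists l V)) V)
    (sum-map-zero (All.tabulate {xs = V} λ {v} _ → Occ*.occurrences-none [] (AllP.map⁺ (All.tabulate {xs = lists l V} λ _ ()))))
  occurrences-lists V (suc l) (y ∷ x) (y∈V ∷ x∈V) = begin
      Occ*.occurrences (y ∷ x) (lists (suc l) V)
    ≡⟨ Occ*.occurrences-concatMap (y ∷ x) (λ v → map (v ∷_) (lists l V)) V ⟩
      sum (map (λ v → Occ*.occurrences (y ∷ x) (map (v ∷_) (lists l V))) V)
    ≡⟨ sum-map-cong (All.tabulate {xs = V} λ {v} _ → occurrences-∷ v) ⟩
      sum (map (λ v → indicator y v ℕ.* Occ*.occurrences x (lists l V)) V)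
    ≡⟨ sum-map-*ʳ (indicator y) V _ ⟨
      occurrences y V ℕ.* Occ*.occurrences x (lists l V)
    ≡⟨ P.cong₂ ℕ._*_ y∈V (occurrences-lists V l x x∈V) ⟩
      1 ℕ.* OccNat.indicator (length x) l
    ≡⟨ ℕP.*-identityˡ _ ⟩
      OccNat.indicator (length (y ∷ x)) (suc l)
    ∎
    where
    open P.≡-Reasoning
    occurrences-∷ : ∀ v → Occ*.occurrences (y ∷ x) (map (v ∷_) (lists l V)) ≡ indicator y v ℕ.* Occ*.occurrences x (lists l V)
    occurrences-∷ v with y ≟ v
    ... | yes P.refl = P.trans (Occ*.occurrences-map-injective (y ∷_) x (lists l V) (All.tabulate λ _ → proj₂ ∘ LP.∷-injective))
                               (P.sym (ℕP.*-identityˡ _))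
    ... | no  y≢v    = Occ*.occurrences-none (y ∷ x) (AllP.map⁺ (All.tabulate {xs = lists l V} λ _ → y≢v ∘ P.sym ∘ proj₁ ∘ LP.∷-injective))

occurrences-upTo : ∀ {N k} → k < N → OccNat.occurrences k (upTo N) ≡ 1
occurrences-upTo {N} k<N = OccNat.occurrences-unique (UniqueP.upTo⁺ N) (MemP.∈-upTo⁺ k<N)

occurrences-map-suc-upTo : ∀ {n k} → 1 ≤ k → k ≤ n → OccNat.occurrences k (map suc (upTo n)) ≡ 1
occurrences-map-suc-upTo {n} {suc k} _ k<n = OccNat.occurrences-unique
  (UniqueP.map⁺ ℕP.suc-injective (UniqueP.upTo⁺ n)) (MemP.∈-map⁺ suc (MemP.∈-upTo⁺ k<n))

All-≤-sum : ∀ (xs : List ℕ) → All (_≤ sum xs) xs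
All-≤-sum []       = []
All-≤-sum (x ∷ xs) = ℕP.m≤m+n x (sum xs) ∷ All.map (λ le → ℕP.≤-trans le (ℕP.m≤n+m (sum xs) x)) (All-≤-sum xs)

length≤sum : ∀ xs → All (1 ≤_) xs → length xs ≤ sum xs
length≤sum []       []       = ℕ.z≤n
length≤sum (x ∷ xs) (p ∷ ps) = ℕP.+-mono-≤ p (length≤sum xs ps)

entry : ∀ {q} → Fin q → List ℕ → ℕ
entry _       []       = 0
entry zero    (x ∷ _)  = x
entry (suc i) (_ ∷ xs) = entry i xs

decAt : ∀ {q} → Fin q → List ℕ → List ℕ
decAt _       []       = []
decAt zero    (x ∷ xs) = ℕ.pred x ∷ xs
decAt (suc i) (x ∷ xs) = x ∷ decAt i xs

∏! : List ℕ → ℕ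
∏! u = product (map _! u)

incAt-decAt : ∀ {q} (i : Fin q) u {c} → entry i u ≡ suc c → incAt i (decAt i u) ≡ u
incAt-decAt zero    (x ∷ u) P.refl = P.refl
incAt-decAt (suc i) (x ∷ u) e      = P.cong (x ∷_) (incAt-decAt i u e)

entry-incAt : ∀ {q} (i : Fin q) v → length v ≡ q → entry i (incAt i v) ≡ suc (entry i v)
entry-incAt zero    (x ∷ v) _   = P.refl
entry-incAt (suc i) (x ∷ v) len = entry-incAt i v (ℕP.suc-injective len)

incAt-injective : ∀ {q} (i : Fin q) {v v′} → incAt i v ≡ incAt i v′ → v ≡ v′
incAt-injective _       {[]}    {[]}     _  = P.refl
incAt-injective zero    {[]}    {_ ∷ _}  ()
incAt-injective (suc i) {[]}    {_ ∷ _}  ()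
incAt-injective zero    {_ ∷ _} {[]}     ()
incAt-injective (suc i) {_ ∷ _} {[]}     ()
incAt-injective zero    {x ∷ v} {y ∷ v′} e = P.cong₂ _∷_ (ℕP.suc-injective (proj₁ (LP.∷-injective e))) (proj₂ (LP.∷-injective e))
incAt-injective (suc i) {x ∷ v} {y ∷ v′} e = P.cong₂ _∷_ (proj₁ (LP.∷-injective e)) (incAt-injective i (proj₂ (LP.∷-injective e)))

length-decAt : ∀ {q} (i : Fin q) u → length (decAt i u) ≡ length u
length-decAt _       []      = P.refl
length-decAt zero    (x ∷ u) = P.refl
length-decAt (suc i) (x ∷ u) = P.cong suc (length-decAt i u)

∏!-decAt : ∀ {q} (i : Fin q) u {c} → entry i u ≡ suc c → ∏! u ≡ suc c ℕ.* ∏! (decAt i u)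
∏!-decAt zero    (x ∷ u) {c} P.refl = ℕP.*-assoc (suc c) (c !) (∏! u)
∏!-decAt (suc i) (x ∷ u) {c} e      = P.trans (P.cong (x ! ℕ.*_) (∏!-decAt i u e)) (x∙yz≈y∙xz (x !) (suc c) _)
  where open import Algebra.Properties.CommutativeSemigroup ℕP.*-commutativeSemigroup using (x∙yz≈y∙xz)

sum-decAt : ∀ {q} (i : Fin q) u {c} → entry i u ≡ suc c → sum u ≡ suc (sum (decAt i u))
sum-decAt zero    (x ∷ u) P.refl = P.refl
sum-decAt (suc i) (x ∷ u) e      = P.trans (P.cong (x ℕ.+_) (sum-decAt i u e)) (ℕP.+-suc x _)

sum-incAt : ∀ {q} (i : Fin q) u → length u ≡ q → sum (incAt i u) ≡ suc (sum u)
sum-incAt zero    (x ∷ u) _   = P.refl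
sum-incAt (suc i) (x ∷ u) len = P.trans (P.cong (x ℕ.+_) (sum-incAt i u (ℕP.suc-injective len))) (ℕP.+-suc x _)

sum-replicate-zero : ∀ n → sum (replicate n 0) ≡ 0
sum-replicate-zero zero    = P.refl
sum-replicate-zero (suc n) = sum-replicate-zero n

sum-multiplicities : ∀ {q} (w : List (Fin q)) → sum (multiplicities {q} w) ≡ length w
sum-multiplicities {q} []      = sum-replicate-zero q
sum-multiplicities     (i ∷ w) = P.trans (sum-incAt i (multiplicities w) (length-multiplicities w)) (P.cong suc (sum-multiplicities w))

sum-tabulate-entry : ∀ q u → length u ≡ q → sum (tabulate {n = q} (λ i → entry i u)) ≡ sum u
sum-tabulate-entry zero    []      _   = P.refl
sum-tabulate-entry (suc q) (x ∷ u) len = P.cong (x ℕ.+_) (sum-tabulate-entry q u (ℕP.suc-injective len))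

sum≡0⇒replicate : ∀ n u → length u ≡ n → sum u ≡ 0 → u ≡ replicate n 0
sum≡0⇒replicate zero    []         _   _ = P.refl
sum≡0⇒replicate (suc n) (zero ∷ u) len s = P.cong (0 ∷_) (sum≡0⇒replicate n u (ℕP.suc-injective len) s)

∏!-replicate-zero : ∀ n → ∏! (replicate n 0) ≡ 1
∏!-replicate-zero zero    = P.refl
∏!-replicate-zero (suc n) = P.trans (ℕP.+-identityʳ _) (∏!-replicate-zero n)

wordMultiplicities : ℕ → ℕ → List (List ℕ)
wordMultiplicities q n = map (multiplicities {q}) (lists n (allFin q))

wordMultiplicities-suc : ∀ q n →
  wordMultiplicities q (suc n) ≡ concatMap (λ i → map (incAt i) (wordMultiplicities q n)) (allFin q)
wordMultiplicities-suc q n = P.trans (LP.map-concatMap multiplicities (λ i → map (i ∷_) W) (allFin q))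
  (LP.concatMap-cong (λ i → P.trans (P.sym (LP.map-∘ W)) (LP.map-∘ W)) (allFin q))
  where W = lists n (allFin q)

length-wordMultiplicities : ∀ q n → All (λ u → length u ≡ q) (wordMultiplicities q n)
length-wordMultiplicities q n = AllP.map⁺ (All.tabulate {xs = lists n (allFin q)} λ {w} _ → length-multiplicities w)

occurrences-wordMultiplicities-≢ : ∀ q n u → sum u ≢ n → OccList.occurrences u (wordMultiplicities q n) ≡ 0
occurrences-wordMultiplicities-≢ q n u sum≢n = OccList.occurrences-none u (AllP.map⁺ (All.map
  (λ {w} len w≡u → sum≢n (P.trans (P.sym (P.cong sum w≡u)) (P.trans (sum-multiplicities w) len)))
  (length-lists n (allFin q))))

occurrences-map-incAt-zero : ∀ {q} (i : Fin q) u {xs} → entry i u ≡ 0 → All (λ x → length x ≡ q) xs →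
  OccList.occurrences u (map (incAt i) xs) ≡ 0
occurrences-map-incAt-zero i u eq lens = OccList.occurrences-none u (AllP.map⁺ (All.map
  (λ {x} len incAt≡u → ℕP.0≢1+n (P.trans (P.sym eq) (P.trans (P.cong (entry i) (P.sym incAt≡u)) (entry-incAt i x len))))
  lens))

occurrences-map-incAt-suc : ∀ {q} (i : Fin q) u {c} xs → entry i u ≡ suc c →
  OccList.occurrences u (map (incAt i) xs) ≡ OccList.occurrences (decAt i u) xs
occurrences-map-incAt-suc i u xs eq =
  P.trans (P.cong (λ z → OccList.occurrences z (map (incAt i) xs)) (P.sym (incAt-decAt i u eq)))
          (OccList.occurrences-map-injective (incAt i) (decAt i u) xs (All.tabulate λ _ → incAt-injective i))

occurrences-wordMultiplicities : ∀ q n u → length u ≡ q → sum u ≡ n →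
  OccList.occurrences u (wordMultiplicities q n) ℕ.* ∏! u ≡ n !
occurrences-wordMultiplicities q zero u len s
  rewrite sum≡0⇒replicate q u len s | OccList.indicator-refl (replicate q 0) | ∏!-replicate-zero q = P.refl
occurrences-wordMultiplicities q (suc n) u len s = begin
    OccList.occurrences u (wordMultiplicities q (suc n)) ℕ.* ∏! u
  ≡⟨ P.cong (λ z → OccList.occurrences u z ℕ.* ∏! u) (wordMultiplicities-suc q n) ⟩
    OccList.occurrences u (concatMap (λ i → map (incAt i) W) I) ℕ.* ∏! u
  ≡⟨ P.cong (ℕ._* ∏! u) (OccList.occurrences-concatMap u (λ i → map (incAt i) W) I) ⟩
    sum (map (λ i → OccList.occurrences u (map (incAt i) W)) I) ℕ.* ∏! u
  ≡⟨ sum-map-*ʳ _ I (∏! u) ⟩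
    sum (map (λ i → OccList.occurrences u (map (incAt i) W) ℕ.* ∏! u) I)
  ≡⟨ sum-map-cong (All.tabulate {xs = I} λ {i} _ → by-last-letter i) ⟩
    sum (map (λ i → entry i u ℕ.* n !) I)
  ≡⟨ sum-map-*ʳ (λ i → entry i u) I (n !) ⟨
    sum (map (λ i → entry i u) I) ℕ.* n !
  ≡⟨ P.cong (ℕ._* n !) (P.trans (P.cong sum (LP.map-tabulate {n = q} (λ i → i) (λ i → entry i u))) (sum-tabulate-entry q u len)) ⟩
    sum u ℕ.* n !
  ≡⟨ P.cong (ℕ._* n !) s ⟩
    suc n !
  ∎
  where
  open P.≡-Reasoning
  I = allFin q
  W = wordMultiplicities q n
  by-last-letter : ∀ i → OccList.occurrences u (map (incAt i) W) ℕ.* ∏! u ≡ entry i u ℕ.* n !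
  by-last-letter i with entry i u in eq
  ... | zero  = P.cong (ℕ._* ∏! u) (occurrences-map-incAt-zero i u eq (length-wordMultiplicities q n))
  ... | suc c = begin
      OccList.occurrences u (map (incAt i) W) ℕ.* ∏! u
    ≡⟨ P.cong₂ ℕ._*_ (occurrences-map-incAt-suc i u W eq) (∏!-decAt i u eq) ⟩
      OccList.occurrences (decAt i u) W ℕ.* (suc c ℕ.* ∏! (decAt i u))
    ≡⟨ x∙yz≈y∙xz (OccList.occurrences (decAt i u) W) (suc c) _ ⟩
      suc c ℕ.* (OccList.occurrences (decAt i u) W ℕ.* ∏! (decAt i u))
    ≡⟨ P.cong (suc c ℕ.*_) (occurrences-wordMultiplicities q n (decAt i u)
         (P.trans (length-decAt i u) len) (ℕP.suc-injective (P.trans (P.sym (sum-decAt i u eq)) s))) ⟩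
      suc c ℕ.* n !
    ∎
    where open import Algebra.Properties.CommutativeSemigroup ℕP.*-commutativeSemigroup using (x∙yz≈y∙xz)

multinomial≡occurrences : ∀ q n u → length u ≡ q → sum u ≡ n → multinomial n u ≡ OccList.occurrences u (wordMultiplicities q n)
multinomial≡occurrences q n u len s =
  P.trans (P.cong (λ z → (z / ∏! u) {{prodFact≢0 u}}) (P.sym (occurrences-wordMultiplicities q n u len s)))
          (m*n/n≡m (OccList.occurrences u (wordMultiplicities q n)) (∏! u) {{prodFact≢0 u}})

insertions-↭ : ∀ (x : A) ys → All (_↭ x ∷ ys) (insertions x ys)
insertions-↭ x []       = ↭-refl ∷ []
insertions-↭ x (y ∷ ys) =
  ↭-refl ∷ AllP.map⁺ (All.map (λ p → ↭-trans (↭-prep y p) (↭-swap y x ↭-refl)) (insertions-↭ x ys))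

perms-↭ : ∀ (xs : List A) → All (_↭ xs) (perms xs)
perms-↭ []       = ↭-refl ∷ []
perms-↭ (x ∷ xs) = AllP.concat⁺ (AllP.map⁺
  (All.map (λ {ys} ys↭xs → All.map (λ p → ↭-trans p (↭-prep x ys↭xs)) (insertions-↭ x ys)) (perms-↭ xs)))

∈-insertions : ∀ (x : A) ys zs → ys ++ x ∷ zs ∈ insertions x (ys ++ zs)
∈-insertions x []       []       = here P.refl
∈-insertions x []       (z ∷ zs) = here P.refl
∈-insertions x (y ∷ ys) zs       = there (MemP.∈-map⁺ (y ∷_) (∈-insertions x ys zs))

↭⇒∈perms : ∀ {ys} (xs : List A) → ys ↭ xs → ys ∈ perms xs
↭⇒∈perms [] p rewrite PermP.↭-empty-inv p = here P.refl
↭⇒∈perms (x ∷ xs) p with MemP.∈-∃++ (PermP.∈-resp-↭ (↭-sym p) (here P.refl))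
... | ys , zs , P.refl =
  MemP.∈-concat⁺′ (∈-insertions x ys zs) (MemP.∈-map⁺ (insertions x) (↭⇒∈perms xs (PermP.drop-mid ys [] p)))

Sym-↭ : ∀ l → All (_↭ l) (Sym l)
Sym-↭ l = All.tabulate (λ γ∈ → All.lookup (perms-↭ l) (MemP.∈-deduplicate⁻ (LP.≡-dec ℕ._≟_) (perms l) γ∈))

occurrences-Sym-↭ : ∀ {γ} l → γ ↭ l → OccList.occurrences γ (Sym l) ≡ 1
occurrences-Sym-↭ l p = OccList.occurrences-unique (UniqueDecP.deduplicate-! (LP.≡-dec ℕ._≟_) (perms l))
  (MemP.∈-deduplicate⁺ (LP.≡-dec ℕ._≟_) (↭⇒∈perms l p))

occurrences-Sym-≁ : ∀ {γ} l → ¬ (γ ↭ l) → OccList.occurrences γ (Sym l) ≡ 0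
occurrences-Sym-≁ {γ} l γ≁l = OccList.occurrences-none γ (All.map (λ { p P.refl → γ≁l p }) (Sym-↭ l))

↭-decreasing-unique : ∀ {xs ys} → Linked _≥_ xs → Linked _≥_ ys → xs ↭ ys → xs ≡ ys
↭-decreasing-unique ↘xs ↘ys p =
  Pointwise-≡⇒≡ (SortedP.↗↭↗⇒≋ (DecTotalOrder.totalOrder ≥-decTotalOrder) ↘xs ↘ys (↭⇒↭ₛ p))

positive? : (x : ℕ) → Dec (1 ≤ x)
positive? = 1 ℕ.≤?_

Linked-≥-0∷ : ∀ {s} → Linked _≥_ (0 ∷ s) → All (_≡ 0) s
Linked-≥-0∷ [-]             = []
Linked-≥-0∷ (ℕ.z≤n ∷ ↘rest) = P.refl ∷ Linked-≥-0∷ ↘rest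

filter-positive-zeros : ∀ {s} → All (_≡ 0) s → filter positive? s ≡ []
filter-positive-zeros []             = P.refl
filter-positive-zeros (P.refl ∷ all0) = filter-positive-zeros all0

zeros≡replicate : ∀ {s} → All (_≡ 0) s → s ≡ replicate (length s) 0
zeros≡replicate []             = P.refl
zeros≡replicate (P.refl ∷ all0) = P.cong (0 ∷_) (zeros≡replicate all0)

decreasing≡pad : ∀ s → Linked _≥_ s → s ≡ pad (length s) (filter positive? s)
decreasing≡pad []            _  = P.refl
decreasing≡pad (zero ∷ s)    ↘s rewrite filter-positive-zeros (Linked-≥-0∷ ↘s) = P.cong (0 ∷_) (zeros≡replicate (Linked-≥-0∷ ↘s))
decreasing≡pad (suc x ∷ s) ↘s = P.cong (suc x ∷_) (decreasing≡pad s (Linked.tail ↘s))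

Linked-≥-pad : ∀ q l → Linked _≥_ l → Linked _≥_ (pad q l)
Linked-≥-pad q l ↘l = go l (q ∸ length l) ↘l
  where
  go : ∀ l k → Linked _≥_ l → Linked _≥_ (l ++ replicate k 0)
  go []          zero          _          = []
  go []          (suc zero)    _          = [-]
  go []          (suc (suc k)) _          = ℕ.z≤n ∷ go [] (suc k) []
  go (x ∷ [])    zero          _          = [-]
  go (x ∷ [])    (suc k)       _          = ℕ.z≤n ∷ go [] (suc k) []
  go (x ∷ y ∷ l) k             (r ∷ ↘l)   = r ∷ go (y ∷ l) k ↘l

pad-injective : ∀ q {l l′} → All (1 ≤_) l → All (1 ≤_) l′ → pad q l ≡ pad q l′ → l ≡ l′
pad-injective q {l} {l′} = go (q ∸ length l) (q ∸ length l′)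
  where
  go : ∀ a b {l l′} → All (1 ≤_) l → All (1 ≤_) l′ → l ++ replicate a 0 ≡ l′ ++ replicate b 0 → l ≡ l′
  go a       b       {[]}    {[]}     _        _        _ = P.refl
  go zero    b       {[]}    {y ∷ _}  _        _        ()
  go (suc a) b       {[]}    {y ∷ _}  _        (p ∷ _)  e = contradiction (P.subst (1 ≤_) (P.sym (proj₁ (LP.∷-injective e))) p) λ ()
  go a       zero    {y ∷ _} {[]}     _        _        ()
  go a       (suc b) {y ∷ _} {[]}     (p ∷ _)  _        e = contradiction (P.subst (1 ≤_) (proj₁ (LP.∷-injective e)) p) λ ()
  go a       b       {y ∷ l} {z ∷ l′} (_ ∷ ps) (_ ∷ ps′) e =
    P.cong₂ _∷_ (proj₁ (LP.∷-injective e)) (go a b ps ps′ (proj₂ (LP.∷-injective e)))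

length-pad : ∀ q l → length l ≤ q → length (pad q l) ≡ q
length-pad q l len≤q =
  P.trans (LP.length-++ l) (P.trans (P.cong (length l ℕ.+_) (LP.length-replicate (q ∸ length l))) (ℕP.m+[n∸m]≡n len≤q))

sum-pad : ∀ q l → sum (pad q l) ≡ sum l
sum-pad q l = P.trans (sum-++ l _) (P.trans (P.cong (sum l ℕ.+_) (sum-replicate-zero (q ∸ length l))) (ℕP.+-identityʳ _))

partitions-IsPartition : ∀ n → All (IsPartition n) (partitions n)
partitions-IsPartition n = AllP.all-filter (isPartition? n) (concatMap (λ len → lists len (map suc (upTo n))) (upTo (suc n)))

partitionsQ-shape : ∀ q n → All (λ l → length l ≡ q × sum l ≡ n × Linked _≥_ l) (partitionsQ q n)
partitionsQ-shape q n = AllP.map⁺ (All.map shape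
  (All.zip (AllP.filter⁺ (λ l → length l ℕ.≤? q) (partitions-IsPartition n) , AllP.all-filter (λ l → length l ℕ.≤? q) (partitions n))))
  where
  shape : ∀ {l} → IsPartition n l × length l ≤ q → length (pad q l) ≡ q × sum (pad q l) ≡ n × Linked _≥_ (pad q l)
  shape {l} ((↘l , _ , sum≡n) , len≤q) = length-pad q l len≤q , P.trans (sum-pad q l) sum≡n , Linked-≥-pad q l ↘l

occurrences-partitions : ∀ n l → IsPartition n l → OccList.occurrences l (partitions n) ≡ 1
occurrences-partitions n l isP@(_ , positive , sum≡n) = begin
    OccList.occurrences l (partitions n)
  ≡⟨ OccList.occurrences-filter (isPartition? n) {l} isP candidates ⟩
    OccList.occurrences l candidates
  ≡⟨ OccList.occurrences-concatMap l (λ len → lists len parts) (upTo (suc n)) ⟩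
    sum (map (λ len → OccList.occurrences l (lists len parts)) (upTo (suc n)))
  ≡⟨ sum-map-cong (All.tabulate {xs = upTo (suc n)} λ {len} _ → occurrences-lists ℕ._≟_ parts len l parts-once) ⟩
    OccNat.occurrences (length l) (upTo (suc n))
  ≡⟨ occurrences-upTo (ℕ.s≤s (ℕP.≤-trans (length≤sum l positive) (ℕP.≤-reflexive sum≡n))) ⟩
    1
  ∎
  where
  open P.≡-Reasoning
  parts = map suc (upTo n)
  candidates = concatMap (λ len → lists len parts) (upTo (suc n))
  parts-once : All (λ y → OccNat.occurrences y parts ≡ 1) l
  parts-once = All.zipWith (λ (1≤y , y≤sum) → occurrences-map-suc-upTo 1≤y (ℕP.≤-trans y≤sum (ℕP.≤-reflexive sum≡n)))
                           (positive , All-≤-sum l)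

occurrences-pad-partitionsQ : ∀ q n l → IsPartition n l → length l ≤ q → OccList.occurrences (pad q l) (partitionsQ q n) ≡ 1
occurrences-pad-partitionsQ q n l isP len≤q = P.trans
  (OccList.occurrences-map-injective (pad q) l short
    (All.map (λ (_ , positive′ , _) → pad-injective q positive′ (proj₁ (proj₂ isP))) (AllP.filter⁺ short? (partitions-IsPartition n))))
  (P.trans (OccList.occurrences-filter short? {l} len≤q (partitions n)) (occurrences-partitions n l isP))
  where
  short? = λ (l : List ℕ) → length l ℕ.≤? q
  short = filter short? (partitions n)

occurrences-sort-partitionsQ : ∀ q n u → length u ≡ q → sum u ≡ n → OccList.occurrences (sort u) (partitionsQ q n) ≡ 1
occurrences-sort-partitionsQ q n u len sum≡n =
  P.subst (λ z → OccList.occurrences z (partitionsQ q n) ≡ 1) (P.sym sorted≡pad)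
          (occurrences-pad-partitionsQ q n positives isPartition len≤q)
  where
  sorted = sort u
  positives = filter positive? sorted
  length-sorted : length sorted ≡ q
  length-sorted = P.trans (PermP.↭-length (sort-↭ u)) len
  sorted≡pad : sorted ≡ pad q positives
  sorted≡pad = P.trans (decreasing≡pad sorted (sort-↗ u)) (P.cong (λ z → pad z positives) length-sorted)
  sum-positives : sum positives ≡ n
  sum-positives = P.trans (P.sym (sum-pad q positives))
    (P.trans (P.cong sum (P.sym sorted≡pad)) (P.trans (sum-↭ (sort-↭ u)) sum≡n))
  isPartition : IsPartition n positives
  isPartition = LinkedP.filter⁺ positive? (λ x≥y y≥z → ℕP.≤-trans y≥z x≥y) (sort-↗ u) , AllP.all-filter positive? sorted , sum-positives
  len≤q : length positives ≤ q
  len≤q = ℕP.≤-trans (LP.length-filter positive? sorted) (ℕP.≤-reflexive length-sorted)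

rearrangements : ℕ → ℕ → List (List ℕ)
rearrangements q n = concatMap Sym (partitionsQ q n)

rearrangements-shape : ∀ q n → All (λ γ → length γ ≡ q × sum γ ≡ n) (rearrangements q n)
rearrangements-shape q n = AllP.concat⁺ (AllP.map⁺ (All.map
  (λ {l} (len , sum≡n , _) → All.map (λ p → P.trans (PermP.↭-length p) len , P.trans (sum-↭ p) sum≡n) (Sym-↭ l))
  (partitionsQ-shape q n)))

occurrences-rearrangements : ∀ q n u → length u ≡ q → sum u ≡ n → OccList.occurrences u (rearrangements q n) ≡ 1
occurrences-rearrangements q n u len sum≡n = P.trans (OccList.occurrences-concatMap u Sym (partitionsQ q n))
  (P.trans (sum-map-cong (All.map in-class-of-sort (partitionsQ-shape q n))) (occurrences-sort-partitionsQ q n u len sum≡n))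
  where
  in-class-of-sort : ∀ {l} → length l ≡ q × sum l ≡ n × Linked _≥_ l → OccList.occurrences u (Sym l) ≡ OccList.indicator (sort u) l
  in-class-of-sort {l} (_ , _ , ↘l) with LP.≡-dec ℕ._≟_ (sort u) l
  ... | yes P.refl  = occurrences-Sym-↭ (sort u) (↭-sym (sort-↭ u))
  ... | no  sort≢l = occurrences-Sym-≁ l λ u↭l → sort≢l (↭-decreasing-unique (sort-↗ u) ↘l (↭-trans (sort-↭ u) u↭l))

occurrences-rearrangements-≢ : ∀ q n u → sum u ≢ n → OccList.occurrences u (rearrangements q n) ≡ 0
occurrences-rearrangements-≢ q n u sum≢n = P.trans (OccList.occurrences-concatMap u Sym (partitionsQ q n))
  (sum-map-zero (All.map (λ {l} (_ , sum≡n , _) → occurrences-Sym-≁ {u} l λ u↭l → sum≢n (P.trans (sum-↭ u↭l) sum≡n)) (partitionsQ-shape q n)))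

occurrences-words≡rearrangements*multinomial : ∀ q n u → length u ≡ q →
  OccList.occurrences u (wordMultiplicities q n) ≡ OccList.occurrences u (rearrangements q n) ℕ.* multinomial n u
occurrences-words≡rearrangements*multinomial q n u len with sum u ℕ.≟ n
... | yes sum≡n rewrite occurrences-rearrangements q n u len sum≡n =
  P.sym (P.trans (ℕP.*-identityˡ _) (multinomial≡occurrences q n u len sum≡n))
... | no  sum≢n rewrite occurrences-rearrangements-≢ q n u sum≢n = occurrences-wordMultiplicities-≢ q n u sum≢n

multinomial-↭ : ∀ n {γ l} → γ ↭ l → multinomial n γ ≡ multinomial n l
multinomial-↭ n {γ} {l} p = /-congʳ {{prodFact≢0 γ}} {{prodFact≢0 l}} (product-↭ (PermP.map⁺ _! p))

occurrences-vectors : ∀ q n x → length x ≡ q → sum x ≡ n → OccList.occurrences x (lists q (upTo (suc n))) ≡ 1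
occurrences-vectors q n x len sum≡n = P.trans
  (occurrences-lists ℕ._≟_ (upTo (suc n)) q x
    (All.map (λ y≤sum → occurrences-upTo (ℕ.s≤s (ℕP.≤-trans y≤sum (ℕP.≤-reflexive sum≡n)))) (All-≤-sum x)))
  (P.trans (P.cong (λ z → OccNat.indicator z q) len) (OccNat.indicator-refl q))

module Regrouping {c ℓ} (R : CommutativeRing c ℓ) where
  open CommutativeRing R
  open RingDefs R
  open RingSums R
  open import Relation.Binary.Reasoning.Setoid setoid
  open import Algebra.Properties.Semiring.Mult semiring using (×-homo-+; ×-homo-1; ×-congˡ; ×-assocˡ)

  Σ'-×-sum : ∀ (g : A → ℕ) x xs → Σ' (map (λ y → g y ·ℕ x) xs) ≈ sum (map g xs) ·ℕ x
  Σ'-×-sum g x []       = refl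
  Σ'-×-sum g x (y ∷ xs) = trans (+-congˡ (Σ'-×-sum g x xs)) (sym (×-homo-+ x (g y) _))

  module _ (_≟_ : DecidableEquality A) where
    open Occurrences _≟_

    Σ'-by-occurrences : ∀ U xs (f : A → Carrier) → All (λ x → occurrences x U ≡ 1) xs →
      Σ' (map f xs) ≈ Σ' (map (λ u → occurrences u xs ·ℕ f u) U)
    Σ'-by-occurrences U []       f []           = sym (Σ'-zero U)
    Σ'-by-occurrences U (x ∷ xs) f (x-once ∷ xs-once) = sym (begin
        Σ' (map (λ u → (indicator u x ℕ.+ occurrences u xs) ·ℕ f u) U)
      ≈⟨ Σ'-cong U (λ u → ×-homo-+ (f u) (indicator u x) (occurrences u xs)) ⟩
        Σ' (map (λ u → indicator u x ·ℕ f u + occurrences u xs ·ℕ f u) U)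
      ≈⟨ Σ'-distrib-+ (λ u → indicator u x ·ℕ f u) (λ u → occurrences u xs ·ℕ f u) U ⟩
        Σ' (map (λ u → indicator u x ·ℕ f u) U) + Σ' (map (λ u → occurrences u xs ·ℕ f u) U)
      ≈⟨ +-cong picks-x (sym (Σ'-by-occurrences U xs f xs-once)) ⟩
        f x + Σ' (map f xs)
      ∎)
      where
      indicator-swap : ∀ u → indicator u x ·ℕ f u ≈ indicator x u ·ℕ f x
      indicator-swap u with u ≟ x | x ≟ u
      ... | yes P.refl | yes _   = refl
      ... | yes P.refl | no x≢x  = contradiction P.refl x≢x
      ... | no u≢x     | yes x≡u = contradiction (P.sym x≡u) u≢x
      ... | no _       | no _    = refl
      picks-x : Σ' (map (λ u → indicator u x ·ℕ f u) U) ≈ f x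
      picks-x = begin
          Σ' (map (λ u → indicator u x ·ℕ f u) U)
        ≈⟨ Σ'-cong U indicator-swap ⟩
          Σ' (map (λ u → indicator x u ·ℕ f x) U)
        ≈⟨ Σ'-×-sum (indicator x) (f x) U ⟩
          occurrences x U ·ℕ f x
        ≡⟨ P.cong (_·ℕ f x) x-once ⟩
          1 ·ℕ f x
        ≈⟨ ×-homo-1 (f x) ⟩
          f x
        ∎

  Σ'-words≈Σ'-partitions : ∀ q n (h : List ℕ → Carrier) →
    Σ' (map (λ w → h (multiplicities {q} w)) (lists n (allFin q))) ≈
    Σ' (map (λ l → multinomial n l ·ℕ Σ' (map h (Sym l))) (partitionsQ q n))
  Σ'-words≈Σ'-partitions q n h = begin
      Σ' (map (λ w → h (multiplicities w)) (lists n (allFin q)))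
    ≡⟨ P.cong Σ' (LP.map-∘ (lists n (allFin q))) ⟩
      Σ' (map h (wordMultiplicities q n))
    ≈⟨ Σ'-by-occurrences (LP.≡-dec ℕ._≟_) vectors (wordMultiplicities q n) h words-once ⟩
      Σ' (map (λ u → OccList.occurrences u (wordMultiplicities q n) ·ℕ h u) vectors)
    ≈⟨ Σ'-cong-All (All.map regroup (length-lists q (upTo (suc n)))) ⟩
      Σ' (map (λ u → OccList.occurrences u (rearrangements q n) ·ℕ (multinomial n u ·ℕ h u)) vectors)
    ≈⟨ Σ'-by-occurrences (LP.≡-dec ℕ._≟_) vectors (rearrangements q n) (λ γ → multinomial n γ ·ℕ h γ) rearrangements-once ⟨
      Σ' (map (λ γ → multinomial n γ ·ℕ h γ) (rearrangements q n))
    ≈⟨ Σ'-concatMap (λ γ → multinomial n γ ·ℕ h γ) Sym (partitionsQ q n) ⟩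
      Σ' (map (λ l → Σ' (map (λ γ → multinomial n γ ·ℕ h γ) (Sym l))) (partitionsQ q n))
    ≈⟨ Σ'-cong (partitionsQ q n) (λ l → sym (trans (×-distrib-Σ' (multinomial n l) h (Sym l))
         (Σ'-cong-All (All.map (λ γ↭l → ×-congˡ (P.sym (multinomial-↭ n γ↭l))) (Sym-↭ l))))) ⟩
      Σ' (map (λ l → multinomial n l ·ℕ Σ' (map h (Sym l))) (partitionsQ q n))
    ∎
    where
    vectors = lists q (upTo (suc n))
    words-once : All (λ u → OccList.occurrences u vectors ≡ 1) (wordMultiplicities q n)
    words-once = AllP.map⁺ (All.map (λ {w} len → occurrences-vectors q n (multiplicities w) (length-multiplicities w)
                                                   (P.trans (sum-multiplicities w) len))
                                    (length-lists n (allFin q)))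
    rearrangements-once : All (λ γ → OccList.occurrences γ vectors ≡ 1) (rearrangements q n)
    rearrangements-once = All.map (λ {γ} (len , sum≡n) → occurrences-vectors q n γ len sum≡n) (rearrangements-shape q n)
    regroup : ∀ {u} → length u ≡ q →
      OccList.occurrences u (wordMultiplicities q n) ·ℕ h u ≈ OccList.occurrences u (rearrangements q n) ·ℕ (multinomial n u ·ℕ h u)
    regroup {u} len = trans (×-congˡ (occurrences-words≡rearrangements*multinomial q n u len))
                            (sym (×-assocˡ (h u) (OccList.occurrences u (rearrangements q n)) (multinomial n u)))

coprime-^ˡ : ∀ {p d} r → Coprime p d → Coprime (p ℕ.^ r) d
coprime-^ˡ zero    _        (i∣1 , _)    = ∣1⇒≡1 i∣1
coprime-^ˡ (suc r) p⊥d {i} (i∣pq , i∣d) =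
  coprime-^ˡ r p⊥d (coprime-divisor (λ (j∣i , j∣p) → p⊥d (j∣p , ∣-trans j∣i i∣d)) i∣pq , i∣d)

module Characteristic {c ℓ} (F : CommutativeRing c ℓ) where
  open CommutativeRing F
  open RingDefs F using (_·ℕ_; _^_; Σ')
  open RingSums F
  open import Relation.Binary.Reasoning.Setoid setoid
  open import Algebra.Properties.Semiring.Mult semiring using (×-homo-+; ×-congʳ; ×-congˡ; ×-assocˡ)
  open import Algebra.Properties.Group +-group using (identityʳ-unique)
  import Algebra.Properties.CommutativeMonoid.Sum +-commutativeMonoid as FinSum

  module _ {N} (enum : Fin N → Carrier) (enum-injective : ∀ i j → enum i ≈ enum j → i ≡ j)
           (index : Carrier → Fin N) (enum-index : ∀ x → enum (index x) ≈ x) where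

    -- translation by x permutes the elements, so Σ y = Σ (y + x) = Σ y + N·x
    size-annihilates : ∀ x → N ·ℕ x ≈ 0#
    size-annihilates x = identityʳ-unique (FinSum.sum enum) (N ·ℕ x) (sym (begin
        FinSum.sum enum
      ≈⟨ FinSum.sum-permute enum (permutation shift unshift shift∘unshift unshift∘shift) ⟩
        FinSum.sum (λ i → enum (shift i))
      ≈⟨ FinSum.sum-cong-≋ (λ i → enum-index (enum i + x)) ⟩
        FinSum.sum (λ i → enum i + x)
      ≈⟨ FinSum.∑-distrib-+ enum (λ _ → x) ⟩
        FinSum.sum enum + FinSum.sum {N} (λ _ → x)
      ≈⟨ +-congˡ (FinSum.sum-replicate N) ⟩
        FinSum.sum enum + N ·ℕ x
      ∎))
      where
      shift unshift : Fin N → Fin N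
      shift i   = index (enum i + x)
      unshift i = index (enum i - x)
      cancels : ∀ i y → (y - x) + x ≈ y × (y + x) - x ≈ y
      cancels i y = trans (+-assoc _ _ _) (trans (+-congˡ (-‿inverseˡ x)) (+-identityʳ y)) ,
                    trans (+-assoc _ _ _) (trans (+-congˡ (-‿inverseʳ x)) (+-identityʳ y))
      shift∘unshift : ∀ i → shift (unshift i) ≡ i
      shift∘unshift i = enum-injective _ _
        (trans (enum-index _) (trans (+-congʳ (enum-index _)) (proj₁ (cancels i (enum i)))))
      unshift∘shift : ∀ i → unshift (shift i) ≡ i
      unshift∘shift i = enum-injective _ _
        (trans (enum-index _) (trans (+-congʳ (enum-index _)) (proj₂ (cancels i (enum i)))))

  ×1-mul-zero : ∀ a k → k ·ℕ 1# ≈ 0# → (a ℕ.* k) ·ℕ 1# ≈ 0#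
  ×1-mul-zero a k k≈0 = trans (sym (×-assocˡ 1# a k)) (trans (×-congʳ a k≈0) (×-zeroʳ a))

  bézout-contradiction : ∀ {u v} a b → 1 ℕ.+ a ℕ.* u ≡ b ℕ.* v → u ·ℕ 1# ≈ 0# → v ·ℕ 1# ≈ 0# → 1# ≈ 0#
  bézout-contradiction {u} {v} a b eq u≈0 v≈0 = begin
      1#
    ≈⟨ sym (trans (+-congˡ (×1-mul-zero a u u≈0)) (trans (+-identityʳ _) (+-identityʳ _))) ⟩
      1 ·ℕ 1# + (a ℕ.* u) ·ℕ 1#
    ≈⟨ ×-homo-+ 1# 1 (a ℕ.* u) ⟨
      (1 ℕ.+ a ℕ.* u) ·ℕ 1#
    ≈⟨ ×-congˡ eq ⟩
      (b ℕ.* v) ·ℕ 1#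
    ≈⟨ ×1-mul-zero b v v≈0 ⟩
      0#
    ∎

  coprime-×1-nonzero : ¬ (1# ≈ 0#) → ∀ {N d} → N ·ℕ 1# ≈ 0# → Coprime N d → ¬ (d ·ℕ 1# ≈ 0#)
  coprime-×1-nonzero 1≉0 N≈0 N⊥d d≈0 with coprime-Bézout N⊥d
  ... | Bézout.+- x y eq = 1≉0 (bézout-contradiction y x eq d≈0 N≈0)
  ... | Bézout.-+ x y eq = 1≉0 (bézout-contradiction x y eq N≈0 d≈0)

  module _ (1≉0 : ¬ (1# ≈ 0#)) {p} (p-prime : Prime p) (r : ℕ) (q≈0 : (p ℕ.^ r) ·ℕ 1# ≈ 0#) where

    ×1-zero-below-prime : ∀ {d} → d < p → d ·ℕ 1# ≈ 0# → d ≡ 0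
    ×1-zero-below-prime {zero}  _   _   = P.refl
    ×1-zero-below-prime {suc d} d<p d≈0 = contradiction d≈0
      (coprime-×1-nonzero 1≉0 q≈0 (coprime-^ˡ r (prime⇒coprime p-prime d<p)))

    ×1-injective-≤ : ∀ {a b} → a ≤ b → b < p → a ·ℕ 1# ≈ b ·ℕ 1# → a ≡ b
    ×1-injective-≤ {a} {b} a≤b b<p eq = P.trans (P.sym (ℕP.+-identityʳ a)) (P.trans
      (P.cong (a ℕ.+_) (P.sym (×1-zero-below-prime (ℕP.≤-<-trans (ℕP.m∸n≤m b a) b<p) difference≈0)))
      (ℕP.m+[n∸m]≡n a≤b))
      where
      difference≈0 : (b ∸ a) ·ℕ 1# ≈ 0#
      difference≈0 = identityʳ-unique (a ·ℕ 1#) _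
        (trans (sym (×-homo-+ 1# a (b ∸ a))) (trans (×-congˡ (ℕP.m+[n∸m]≡n a≤b)) (sym eq)))

    ×1-injective-below : ∀ {a b} → a < p → b < p → a ·ℕ 1# ≈ b ·ℕ 1# → a ≡ b
    ×1-injective-below {a} {b} a<p b<p eq with ℕP.≤-total a b
    ... | inj₁ a≤b = ×1-injective-≤ a≤b b<p eq
    ... | inj₂ b≤a = P.sym (×1-injective-≤ b≤a a<p (sym eq))

    trace-cong : (tr : Carrier → Fin p) → (∀ a → toℕ (tr a) ·ℕ 1# ≈ Σ' (map (λ j → a ^ (p ℕ.^ j)) (upTo r))) →
      ∀ {a b} → a ≈ b → tr a ≡ tr b
    trace-cong tr tr-spec {a} {b} a≈b = FinP.toℕ-injective (×1-injective-below (FinP.toℕ<n (tr a)) (FinP.toℕ<n (tr b))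
      (trans (tr-spec a) (trans (Σ'-cong (upTo r) (λ j → ^-congˡ (p ℕ.^ j) a≈b)) (sym (tr-spec b)))))
      where open import Algebra.Properties.Semiring.Exp semiring using (^-congˡ)

lists-map : ∀ (f : A → B) l xs → lists l (map f xs) ≡ map (map f) (lists l xs)
lists-map f zero    xs = P.refl
lists-map f (suc l) xs = begin
    concatMap (λ v → map (v ∷_) (lists l (map f xs))) (map f xs)
  ≡⟨ P.cong (λ L → concatMap (λ v → map (v ∷_) L) (map f xs)) (lists-map f l xs) ⟩
    concatMap (λ v → map (v ∷_) (map (map f) (lists l xs))) (map f xs)
  ≡⟨ LP.concatMap-map (λ v → map (v ∷_) (map (map f) (lists l xs))) f xs ⟩
    concatMap (λ x → map (f x ∷_) (map (map f) (lists l xs))) xs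
  ≡⟨ LP.concatMap-cong (λ x → P.trans (P.sym (LP.map-∘ (lists l xs))) (LP.map-∘ (lists l xs))) xs ⟩
    concatMap (λ x → map (map f) (map (x ∷_) (lists l xs))) xs
  ≡⟨ LP.map-concatMap (map f) (λ x → map (x ∷_) (lists l xs)) xs ⟨
    map (map f) (lists (suc l) xs)
  ∎
  where open P.≡-Reasoning

module FieldEnumeration {c ℓ} (F : CommutativeRing c ℓ) {m} (α : Fin m → CommutativeRing.Carrier F)
  (α≉0 : ∀ i → ¬ (CommutativeRing._≈_ F (α i) (CommutativeRing.0# F)))
  (α-injective : ∀ i j → CommutativeRing._≈_ F (α i) (α j) → i ≡ j)
  (α-covers : ∀ x → CommutativeRing._≈_ F x (CommutativeRing.0# F) ⊎ ∃ λ i → CommutativeRing._≈_ F x (α i)) where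
  open CommutativeRing F hiding (zero)

  index : Carrier → Fin (suc m)
  index x with α-covers x
  ... | inj₁ _       = zero
  ... | inj₂ (i , _) = suc i

  withZero-index : ∀ x → withZero F α (index x) ≈ x
  withZero-index x with α-covers x
  ... | inj₁ x≈0       = sym x≈0
  ... | inj₂ (i , x≈α) = sym x≈α

  withZero-injective : ∀ i j → withZero F α i ≈ withZero F α j → i ≡ j
  withZero-injective zero    zero    _   = P.refl
  withZero-injective zero    (suc j) 0≈α = contradiction (sym 0≈α) (α≉0 j)
  withZero-injective (suc i) zero    α≈0 = contradiction α≈0 (α≉0 i)
  withZero-injective (suc i) (suc j) α≈α = P.cong suc (α-injective i j α≈α)

prime-power-≥2 : ∀ {p} r → Prime p → 1 ≤ r → 2 ≤ p ℕ.^ r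
prime-power-≥2 {p} r p-prime 1≤r = ℕP.≤-trans (ℕ.nonTrivial⇒n>1 p {{prime⇒nonTrivial p-prime}})
  (ℕP.≤-trans (ℕP.≤-reflexive (P.sym (ℕP.*-identityʳ p))) (ℕP.^-monoʳ-≤ p {{prime⇒nonZero p-prime}} 1≤r))

module CharacterSum {c ℓ c′ ℓ′} (F : CommutativeRing c ℓ) (1≉0 : ¬ (CommutativeRing._≈_ F (CommutativeRing.1# F) (CommutativeRing.0# F)))
  {p r} (p-prime : Prime p) (1≤r : 1 ≤ r) (α : Fin (p ℕ.^ r ∸ 1) → CommutativeRing.Carrier F)
  (α≉0 : ∀ i → ¬ (CommutativeRing._≈_ F (α i) (CommutativeRing.0# F)))
  (α-injective : ∀ i j → CommutativeRing._≈_ F (α i) (α j) → i ≡ j)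
  (α-covers : ∀ x → CommutativeRing._≈_ F x (CommutativeRing.0# F) ⊎ ∃ λ i → CommutativeRing._≈_ F x (α i))
  (tr : CommutativeRing.Carrier F → Fin p)
  (tr-spec : ∀ a → CommutativeRing._≈_ F (RingDefs._·ℕ_ F (toℕ (tr a)) (CommutativeRing.1# F))
                                       (RingDefs.Σ' F (map (λ j → RingDefs._^_ F a (p ℕ.^ j)) (upTo r))))
  (R : CommutativeRing c′ ℓ′) (ζ : CommutativeRing.Carrier R) where
  open Sides F R p r α tr ζ public
  open RingDefs F using (Σ'; Λ; _·ℕ_)
  open FieldEnumeration F α α≉0 α-injective α-covers
  open ElementarySymmetricOfWords F α using (letter; e≈Λ-multiplicities)

  m : ℕ
  m = p ℕ.^ r ∸ 1

  1+m≡q : suc m ≡ q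
  1+m≡q = ℕP.m+[n∸m]≡n (ℕP.≤-trans (ℕ.s≤s ℕ.z≤n) (prime-power-≥2 r p-prime 1≤r))

  1≤m : 1 ≤ m
  1≤m = ℕP.∸-monoˡ-≤ 1 (prime-power-≥2 r p-prime 1≤r)

  elems≡map-letter : elems ≡ map letter (allFin (suc m))
  elems≡map-letter = P.cong (FF.0# ∷_) (P.trans (LP.map-tabulate (λ i → i) α) (P.sym (LP.map-tabulate suc letter)))

  q·1≈0 : q ·ℕ FF.1# FF.≈ FF.0#
  q·1≈0 = P.subst (λ N → N ·ℕ FF.1# FF.≈ FF.0#) 1+m≡q
    (Characteristic.size-annihilates F letter withZero-injective index withZero-index FF.1#)

  ψ-cong : ∀ {a b} → a FF.≈ b → ψ a ≡ ψ b
  ψ-cong a≈b = P.cong (λ t → ζ RD.^ toℕ t) (Characteristic.trace-cong F 1≉0 p-prime r q·1≈0 tr tr-spec a≈b)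

  summand : List FF.Carrier → List ℕ → List ℕ → RR.Carrier
  summand βs ks γ = ψ (Σ' (zipWith (λ b k → b FF.* Λ αs (+ k) (drop 1 γ)) βs ks))

  LHS≈Σ'-words : ∀ n βs ks → LHS n βs ks RR.≈ RD.Σ' (map (λ w → summand βs ks (multiplicities w)) (lists n (allFin (suc m))))
  LHS≈Σ'-words n βs ks = begin
      RD.Σ' (map (λ x → ψ (Fpoly βs ks x)) (lists n elems))
    ≡⟨ P.cong (λ xs → RD.Σ' (map (λ x → ψ (Fpoly βs ks x)) xs))
         (P.trans (P.cong (lists n) elems≡map-letter) (lists-map letter n (allFin (suc m)))) ⟩
      RD.Σ' (map (λ x → ψ (Fpoly βs ks x)) (map (map letter) words))
    ≡⟨ P.cong RD.Σ' (LP.map-∘ words) ⟨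
      RD.Σ' (map (λ w → ψ (Fpoly βs ks (map letter w))) words)
    ≈⟨ RingSums.Σ'-cong R words (λ w → RR.reflexive (ψ-cong
         (RingSums.Σ'-zipWith-cong F βs ks λ b k → FF.*-congˡ (e≈Λ-multiplicities 1≤m w k)))) ⟩
      RD.Σ' (map (λ w → summand βs ks (multiplicities w)) words)
    ∎
    where
    open import Relation.Binary.Reasoning.Setoid RR.setoid
    words = lists n (allFin (suc m))

open import Data.Nat using (_^_)

corollary3p5 : ∀ {c ℓ c' ℓ' : Level}
    (F : CommutativeRing c ℓ) → RingDefs.IsField F →
    (p r : ℕ) → Prime p → 1 ≤ r →
    (α : Fin (p ^ r ∸ 1) → CommutativeRing.Carrier F) →
    (∀ i → ¬ (CommutativeRing._≈_ F (α i) (CommutativeRing.0# F))) →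
    (∀ i j → CommutativeRing._≈_ F (α i) (α j) → i ≡ j) →
    (∀ x → CommutativeRing._≈_ F x (CommutativeRing.0# F) ⊎ ∃ λ i → CommutativeRing._≈_ F x (α i)) →
    (tr : CommutativeRing.Carrier F → Fin p) →
    (∀ a → CommutativeRing._≈_ F (RingDefs._·ℕ_ F (toℕ (tr a)) (CommutativeRing.1# F))
                                 (RingDefs.Σ' F (map (λ j → RingDefs._^_ F a (p ^ j)) (upTo r)))) →
    (R : CommutativeRing c' ℓ') (ζ : CommutativeRing.Carrier R) →
    CommutativeRing._≈_ R (RingDefs._^_ R ζ p) (CommutativeRing.1# R) →
    (n : ℕ) → 1 ≤ n →
    (ks : List ℕ) (βs : List (CommutativeRing.Carrier F)) →
    1 ≤ length ks → length βs ≡ length ks →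
    All (1 ≤_) ks → Linked _<_ ks →
    All (λ b → ¬ (CommutativeRing._≈_ F b (CommutativeRing.0# F))) βs →
    CommutativeRing._≈_ R (Sides.LHS F R p r α tr ζ n βs ks) (Sides.RHS F R p r α tr ζ n βs ks)
corollary3p5 F (1≉0 , _) p r p-prime 1≤r α α≉0 α-injective α-covers tr tr-spec R ζ _ n _ ks βs _ _ _ _ _ = begin
    LHS n βs ks
  ≈⟨ LHS≈Σ'-words n βs ks ⟩
    RD.Σ' (map (λ w → summand βs ks (multiplicities w)) (lists n (allFin (suc m))))
  ≈⟨ Regrouping.Σ'-words≈Σ'-partitions R (suc m) n (summand βs ks) ⟩
    RD.Σ' (map (λ l → multinomial n l RD.·ℕ RD.Σ' (map (summand βs ks) (Sym l))) (partitionsQ (suc m) n))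
  ≡⟨ P.cong (λ Q → RD.Σ' (map (λ l → multinomial n l RD.·ℕ RD.Σ' (map (summand βs ks) (Sym l))) (partitionsQ Q n))) 1+m≡q ⟩
    RHS n βs ks
  ∎
  where
  open CharacterSum F 1≉0 p-prime 1≤r α α≉0 α-injective α-covers tr tr-spec R ζ
  open import Relation.Binary.Reasoning.Setoid RR.setoid
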